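{- Let $n\ge2$. The map $\beta^2$ sends $\mathrm{sol}(B_n)$ onto $\mathrm{sol}(B_{n-2})$ and there is a commutative diagram $$\begin{array}{ccccccccc}0&\to&\mathrm{Span}\{x_n,x_{n-1}\}&\hookrightarrow&\mathrm{sol}(B_n)&\xrightarrow{\beta^2}&\mathrm{sol}(B_{n-2})&\to&0\\ &&\downarrow\varphi&&\downarrow\varphi&&\downarrow\varphi&&\\ 0&\to&\mathrm{Span}\{\sum_{j=0}^{\lfloor n/2\rfloor}p_j\}&\hookrightarrow&\wp_n&\xrightarrow{\pi}&\wp_{n-2}&\to&0\end{array}$$ in which both rows are exact and the vertical maps are surjective.
   Context: Type B: $\mathcal B_m$ is the group of signed permutations (bijections $w$ of $\{\pm1,\dots,\pm m\}$ with $w(-i)=-w(i)$), written $w_1\cdots w_m$, negative entries $\bar k=-k$, ordered $\cdots<\bar2<\bar1<1<2<\cdots$; $\mathrm{Des}(w)=\{i\in\{0,\dots,m-1\}:w_i>w_{i+1}\}$ with $w_0=0$. For $J\subseteq\{0,\dots,m-1\}$, $Y_J=\sum_{\mathrm{Des}(w)=J}w$, $X_J=\sum_{I\subseteq J}Y_I$. $y_j=\sum_{\#J=j}Y_J$ and $x_j=\sum_{\#J=j}X_J$ for $j=0,\dots,m$; $\mathrm{sol}(B_m)=\mathrm{Span}\{y_0,\dots,y_m\}$. For a set $J$ of integers, $J-2=\{j-2:j\in J\}$. $\beta^2$ is the linear map on the span of the $X_J$ with $X_J\mapsto X_{J-2}$ if $0,1\notin J$ and $X_J\mapsto 0$ otherwise.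 $\varphi$ is the linear map forgetting signs. Type A: for $u\in\mathcal S_m$, $\mathrm{Peak}(u)=\{i\in\{1,\dots,m-1\}:u_{i-1}<u_i>u_{i+1}\}$ with $u_0=0$; $P_F=\sum_{\mathrm{Peak}(u)=F}u$ for $F$ a subset of $\{1,\dots,m-1\}$ with no two consecutive integers; $p_j=\sum_{\#\mathrm{Peak}(u)=j}u$, $\wp_m=\mathrm{Span}\{p_0,\dots,p_{\lfloor m/2\rfloor}\}$. $\pi$ is the linear map from the span of the $P_F$ (for $\mathcal S_n$) to that for $\mathcal S_{n-2}$ with $P_F\mapsto P_{F-2}$ if $1,2\notin F$; $P_F\mapsto-P_{(F\setminus\{1\})-2}$ if $1\in F$; $P_F\mapsto0$ if $2\in F$. -}

module Defs where

open import Data.Bool using (Bool; true; false; if_then_else_; _∧_; not)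
open import Data.Nat using (ℕ; zero; suc; _/_)
import Data.Nat as ℕ
import Data.Nat.Properties as ℕP
open import Data.Integer using (ℤ; +_; -[1+_]; 0ℤ)
import Data.Integer.Properties as ℤP
open import Data.Rational using (ℚ; 0ℚ; 1ℚ; _+_; _*_; -_)
open import Data.Fin using (Fin; toℕ)
import Data.Fin as Fin
open import Data.Fin.Permutation using (Permutation′; _⟨$⟩ʳ_)
open import Data.Fin.Subset using (Subset; _⊆_; ∣_∣)
open import Data.Fin.Subset.Properties using (_⊆?_)
open import Data.Vec using (Vec; []; _∷_; tabulate; lookup)
open import Data.Vec.Properties using (≡-dec)
import Data.Bool.Properties as BoolP
open import Data.List using (List; []; _∷_; [_]; map; _++_; filter; foldr)
open import Data.List using () renaming (allFin to allFinL)
open import Data.Product using (Σ; _×_; _,_; ∃)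
open import Relation.Nullary.Decidable using (⌊_⌋; Dec)
open import Relation.Binary.PropositionalEquality using (_≡_)

⅀ : {I A : Set} → List I → (I → A → ℚ) → A → ℚ
⅀ L f a = foldr (λ i r → f i a + r) 0ℚ L

_≗ℚ_ : {A : Set} → (A → ℚ) → (A → ℚ) → Set
f ≗ℚ g = ∀ a → f a ≡ g a

zeroV : {A : Set} → A → ℚ
zeroV _ = 0ℚ

InSpan : {A : Set} (k : ℕ) → (Fin k → A → ℚ) → (A → ℚ) → Set
InSpan k g v = Σ (Fin k → ℚ) λ c → v ≗ℚ ⅀ (allFinL k) (λ i a → c i * g i a)

allSubsets : (n : ℕ) → List (Subset n)
allSubsets zero    = [ [] ]
allSubsets (suc n) = map (false ∷_) (allSubsets n) ++ map (true ∷_) (allSubsets n)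

_≟S_ : {n : ℕ} → (J K : Subset n) → Dec (J ≡ K)
_≟S_ = ≡-dec BoolP._≟_

desVec : {m : ℕ} → Vec ℤ (suc m) → Vec Bool m
desVec {zero}  (x ∷ [])    = []
desVec {suc m} (x ∷ y ∷ r) = ⌊ y ℤP.<? x ⌋ ∷ desVec (y ∷ r)

peaks3 : {k : ℕ} → Vec ℕ (suc (suc k)) → Vec Bool k
peaks3 {zero}  _               = []
peaks3 {suc k} (a ∷ b ∷ c ∷ r) = (⌊ a ℕP.<? b ⌋ ∧ ⌊ c ℕP.<? b ⌋) ∷ peaks3 (b ∷ c ∷ r)

-- for a word u_0 … u_m, the peak set as a subset of {0,…,m-1}
-- (position 0 is never a peak; positions 1..m-1 are tested)
peakVec : {m : ℕ} → Vec ℕ (suc m) → Vec Bool m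
peakVec {zero}  _ = []
peakVec {suc m} v = false ∷ peaks3 v

-- w = (σ , s): w_i = ± (σ(i) + 1), negative iff s contains i (0-indexed positions)
SPerm : ℕ → Set
SPerm m = Permutation′ m × Subset m

entryB : {m : ℕ} → SPerm m → Fin m → ℤ
entryB (σ , s) i with lookup s i
... | true  = -[1+ toℕ (σ ⟨$⟩ʳ i) ]
... | false = + suc (toℕ (σ ⟨$⟩ʳ i))

-- Des(w) ⊆ {0,…,m-1} with w_0 = 0
Des : {m : ℕ} → SPerm m → Subset m
Des w = desVec (0ℤ ∷ tabulate (entryB w))

QB : ℕ → Set
QB m = SPerm m → ℚ

Y : {m : ℕ} → Subset m → QB m
Y J w = if ⌊ Des w ≟S J ⌋ then 1ℚ else 0ℚ

X : {m : ℕ} → Subset m → QB m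
X {m} J = ⅀ (filter (_⊆? J) (allSubsets m)) Y

yB : (m j : ℕ) → QB m
yB m j = ⅀ (filter (λ J → ∣ J ∣ ℕ.≟ j) (allSubsets m)) Y

xB : (m j : ℕ) → QB m
xB m j = ⅀ (filter (λ J → ∣ J ∣ ℕ.≟ j) (allSubsets m)) X

InSol : (m : ℕ) → QB m → Set
InSol m = InSpan (suc m) (λ i → yB m (toℕ i))

-- β² as a relation "β²(v) = u" on the span of the X_J (J ⊆ {0,…,n-1}, n = k+2):
-- v = Σ_J a_J X_J and u = Σ_{J : 0,1 ∉ J} a_J X_{J-2}.
-- A subset J with 0,1 ∉ J is  false ∷ false ∷ J'  and  J - 2 = J'.
Beta2 : (k : ℕ) → QB (suc (suc k)) → QB k → Set
Beta2 k v u = Σ (Subset (suc (suc k)) → ℚ) λ a →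
    (v ≗ℚ ⅀ (allSubsets (suc (suc k))) (λ J w → a J * X J w))
  × (u ≗ℚ ⅀ (allSubsets k) (λ J' w → a (false ∷ false ∷ J') * X J' w))

QS : ℕ → Set
QS m = Permutation′ m → ℚ

entryA : {m : ℕ} → Permutation′ m → Fin m → ℕ
entryA σ i = suc (toℕ (σ ⟨$⟩ʳ i))

-- Peak(u) ⊆ {1,…,m-1}, encoded as a subset of {0,…,m-1}, with u_0 = 0
Peak : {m : ℕ} → Permutation′ m → Subset m
Peak u = peakVec (0 ∷ tabulate (entryA u))

noConsec : {m : ℕ} → Vec Bool m → Bool
noConsec []               = true
noConsec (b ∷ [])         = true
noConsec (b ∷ c ∷ r)      = not (b ∧ c) ∧ noConsec (c ∷ r)

isPeakSet : {m : ℕ} → Subset m → Bool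
isPeakSet []      = true
isPeakSet (b ∷ r) = not b ∧ noConsec (b ∷ r)

peakSets : (m : ℕ) → List (Subset m)
peakSets m = filter (λ F → isPeakSet F BoolP.≟ true) (allSubsets m)

P : {m : ℕ} → Subset m → QS m
P F u = if ⌊ Peak u ≟S F ⌋ then 1ℚ else 0ℚ

pA : (m j : ℕ) → QS m
pA m j u = if ⌊ ∣ Peak u ∣ ℕ.≟ j ⌋ then 1ℚ else 0ℚ

InPeakSpan : (m : ℕ) → QS m → Set
InPeakSpan m = InSpan (suc (m / 2)) (λ i → pA m (toℕ i))

sumP : (m : ℕ) → QS m
sumP m = ⅀ (allFinL (suc (m / 2))) (λ i → pA m (toℕ i))

-- image of P_F under π  (F ⊆ {0,…,k+1}, F = f0 ∷ f1 ∷ F', F - 2 = F'):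
-- 0 if 2 ∈ F;  - P_{(F∖{1})-2} if 1 ∈ F;  P_{F-2} otherwise
headOr : {k : ℕ} → Vec Bool k → Bool
headOr []      = false
headOr (b ∷ _) = b

piP : {k : ℕ} → Subset (suc (suc k)) → QS k
piP (f0 ∷ f1 ∷ F') u =
  if headOr F' then 0ℚ else (if f1 then - P F' u else P F' u)

Pi : (k : ℕ) → QS (suc (suc k)) → QS k → Set
Pi k v u = Σ (Subset (suc (suc k)) → ℚ) λ b →
    (v ≗ℚ ⅀ (peakSets (suc (suc k))) (λ F σ → b F * P F σ))
  × (u ≗ℚ ⅀ (peakSets (suc (suc k))) (λ F σ → b F * piP F σ))

-- φ : ℚ[B_m] → ℚ[S_m], forgetting signs (linear extension of (σ , s) ↦ σ)
φ : {m : ℕ} → QB m → QS m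
φ {m} v σ = ⅀ (allSubsets m) (λ s _ → v (σ , s)) σ

xTop : (k : ℕ) → Fin 2 → QB (suc (suc k))
xTop k Fin.zero    = xB (suc (suc k)) (suc (suc k))
xTop k (Fin.suc _) = xB (suc (suc k)) (suc k)


InX : (k : ℕ) → QB (suc (suc k)) → Set
InX k = InSpan 2 (xTop k)

InΣp : (m : ℕ) → QS m → Set
InΣp m = InSpan 1 (λ _ → sumP m)

-- An element Σ a_J X_J of ℚ[B_n] is the function w ↦ Σ_{J ⊇ Des w} a_J of the descent set, and by
-- Möbius inversion every function of Des arises; sol(B_n) consists of the functions g ∘ des.
-- Evaluating at the identity with the entries in D negated, whose descent set is D, shows that β²
-- is the mixed second difference in the positions 0 and 1, hence sends g ∘ des to Δ²g ∘ des; its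
-- kernel is given by the g affine on [0, n], that is Span{x_n, x_{n-1}} as x_n = 1 and
-- x_{n-1} = n − des. Likewise ℘_n consists of the functions f ∘ pk, and evaluating at 1 2 (τ+2) and
-- 2 1 (τ+2) shows that π sends f ∘ pk to (f − f ∘ suc) ∘ pk.
-- Summing g ∘ des over the signs of σ gives 4^p Σᵢ C(n − 2p, i) g(p + i) with p = pk σ: whatever
-- their signs, a peak adds one descent and a valley none, and any other letter adds one descent
-- for exactly one of its two signs. In this form Δ² becomes the difference in p, and the formula
-- can be inverted by induction on n.

module Submission where

open import Defs
open import Data.Nat using (ℕ; suc)
open import Data.Fin using (Fin; zero; suc)
open import Data.Product using (Σ; _×_)

open import Data.Nat using (zero; _≤_; _<_; z≤n; s≤s; _≟_; _<?_; _/_)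
import Data.Nat as ℕ
import Data.Nat.Properties as ℕₚ
open import Data.Nat.DivMod using (m*n/n≡m; /-monoˡ-≤)
open import Data.Fin using (toℕ)
import Data.Fin.Properties as Fin
open import Data.Product using (_,_; proj₁; proj₂; uncurry)
open import Data.Unit using (⊤; tt)
open import Data.Bool using (Bool; true; false; if_then_else_; not; _∧_)
import Data.Bool.Properties as Bool
open import Data.List using (List; []; _∷_; _++_; filter; foldr)
open import Data.List using () renaming (allFin to allFinL)
import Data.List as List
open import Data.Vec using (Vec; []; _∷_; lookup; tabulate)
import Data.Vec as Vec
import Data.Vec.Properties as Vec
open import Data.Integer using (ℤ; 0ℤ) renaming (_≤_ to _≤ℤ_; -_ to -ℤ_)
import Data.Integer as ℤ
import Data.Integer.Properties as ℤ
open import Data.Fin.Subset using (Subset; ∣_∣)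
open import Data.Fin.Subset.Properties using (_⊆?_; ∣p∣≤n)
open import Data.Fin.Permutation using (Permutation′; _⟨$⟩ʳ_; _⟨$⟩ˡ_; inverseˡ; lift₀; swap)
import Data.Fin.Permutation as Perm
open import Data.Rational using (ℚ; 0ℚ; 1ℚ; ½; _+_; _*_; -_; _-_)
import Data.Rational.Properties as ℚ
open import Data.Rational.Solver using (module +-*-Solver)
open import Algebra.Definitions.RawSemiring ℚ.+-*-rawSemiring using (_^_) renaming (_×_ to _·_)
open import Algebra.Properties.Group ℚ.+-0-group using (x∙y⁻¹≈ε⇒x≈y)
open import Relation.Nullary using (Dec; does; yes; no; ¬_; contradiction)
open import Relation.Nullary.Decidable using (⌊_⌋; isYes≗does; dec-true; dec-false)
open import Relation.Binary.Definitions using (tri<; tri≈; tri>)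
open import Relation.Binary.PropositionalEquality
open import Function using (_∘_)

open ≡-Reasoning
open +-*-Solver using (solve; _:+_; _:*_; :-_; _:-_; _:=_; con)

𝟙 : Bool → ℚ
𝟙 b = if b then 1ℚ else 0ℚ

sumOver : {I : Set} → List I → (I → ℚ) → ℚ
sumOver L h = foldr (λ i r → h i + r) 0ℚ L

sumOver-cong : {I : Set} (L : List I) {h h′ : I → ℚ} → (∀ i → h i ≡ h′ i) → sumOver L h ≡ sumOver L h′
sumOver-cong []      e = refl
sumOver-cong (i ∷ L) e = cong₂ _+_ (e i) (sumOver-cong L e)

sumOver-zero : {I : Set} (L : List I) {h : I → ℚ} → (∀ i → h i ≡ 0ℚ) → sumOver L h ≡ 0ℚ
sumOver-zero []      e = refl
sumOver-zero (i ∷ L) e = trans (cong₂ _+_ (e i) (sumOver-zero L e)) (ℚ.+-identityˡ 0ℚ)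

sumOver-++ : {I : Set} (L M : List I) (h : I → ℚ) → sumOver (L ++ M) h ≡ sumOver L h + sumOver M h
sumOver-++ []      M h = sym (ℚ.+-identityˡ _)
sumOver-++ (i ∷ L) M h = trans (cong (h i +_) (sumOver-++ L M h)) (sym (ℚ.+-assoc (h i) _ _))

sumOver-map : {I J : Set} (f : I → J) (L : List I) (h : J → ℚ) → sumOver (List.map f L) h ≡ sumOver L (h ∘ f)
sumOver-map f []      h = refl
sumOver-map f (i ∷ L) h = cong (h (f i) +_) (sumOver-map f L h)

sumOver-filter : {I : Set} {P : I → Set} (P? : ∀ i → Dec (P i)) (L : List I) (h : I → ℚ) →
  sumOver (filter P? L) h ≡ sumOver L (λ i → if does (P? i) then h i else 0ℚ)
sumOver-filter P? []      h = refl
sumOver-filter P? (i ∷ L) h with does (P? i)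
... | true  = cong (h i +_) (sumOver-filter P? L h)
... | false = trans (sumOver-filter P? L h) (sym (ℚ.+-identityˡ _))

if-zero : (b : Bool) → (if b then 0ℚ else 0ℚ) ≡ 0ℚ
if-zero true  = refl
if-zero false = refl

if≡𝟙* : (b : Bool) (x : ℚ) → (if b then x else 0ℚ) ≡ 𝟙 b * x
if≡𝟙* true  x = sym (ℚ.*-identityˡ x)
if≡𝟙* false x = sym (ℚ.*-zeroˡ x)

sumOver-allSubsets-suc : (m : ℕ) (h : Subset (suc m) → ℚ) →
  sumOver (allSubsets (suc m)) h ≡ sumOver (allSubsets m) (h ∘ (false ∷_)) + sumOver (allSubsets m) (h ∘ (true ∷_))
sumOver-allSubsets-suc m h = begin
  sumOver (List.map (false ∷_) (allSubsets m) ++ List.map (true ∷_) (allSubsets m)) h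
    ≡⟨ sumOver-++ (List.map (false ∷_) (allSubsets m)) _ h ⟩
  sumOver (List.map (false ∷_) (allSubsets m)) h + sumOver (List.map (true ∷_) (allSubsets m)) h
    ≡⟨ cong₂ _+_ (sumOver-map (false ∷_) (allSubsets m) h) (sumOver-map (true ∷_) (allSubsets m) h) ⟩
  sumOver (allSubsets m) (h ∘ (false ∷_)) + sumOver (allSubsets m) (h ∘ (true ∷_)) ∎

sumOver-allSubsets-single : (m : ℕ) (D : Subset m) (h : Subset m → ℚ) →
  (∀ J → D ≢ J → h J ≡ 0ℚ) → sumOver (allSubsets m) h ≡ h D
sumOver-allSubsets-single zero [] h _ = ℚ.+-identityʳ (h [])
sumOver-allSubsets-single (suc m) (false ∷ D) h off = begin
  sumOver (allSubsets (suc m)) h                                    ≡⟨ sumOver-allSubsets-suc m h ⟩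
  sumOver (allSubsets m) (h ∘ (false ∷_)) + sumOver (allSubsets m) (h ∘ (true ∷_))
    ≡⟨ cong₂ _+_ (sumOver-allSubsets-single m D (h ∘ (false ∷_))
                    (λ J D≢J → off (false ∷ J) (D≢J ∘ Vec.∷-injectiveʳ)))
                 (sumOver-zero (allSubsets m) (λ J → off (true ∷ J) λ ())) ⟩
  h (false ∷ D) + 0ℚ                                                ≡⟨ ℚ.+-identityʳ _ ⟩
  h (false ∷ D)                                                     ∎
sumOver-allSubsets-single (suc m) (true ∷ D) h off = begin
  sumOver (allSubsets (suc m)) h                                    ≡⟨ sumOver-allSubsets-suc m h ⟩
  sumOver (allSubsets m) (h ∘ (false ∷_)) + sumOver (allSubsets m) (h ∘ (true ∷_))
    ≡⟨ cong₂ _+_ (sumOver-zero (allSubsets m) (λ J → off (false ∷ J) λ ()))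
                 (sumOver-allSubsets-single m D (h ∘ (true ∷_))
                    (λ J D≢J → off (true ∷ J) (D≢J ∘ Vec.∷-injectiveʳ))) ⟩
  0ℚ + h (true ∷ D)                                                 ≡⟨ ℚ.+-identityˡ _ ⟩
  h (true ∷ D)                                                      ∎

sumOver-tabulate : {I : Set} {n : ℕ} (f : Fin n → I) (h : I → ℚ) → sumOver (List.tabulate f) h ≡ sumOver (allFinL n) (h ∘ f)
sumOver-tabulate {n = zero}  f h = refl
sumOver-tabulate {n = suc n} f h =
  cong (h (f zero) +_) (trans (sumOver-tabulate (f ∘ suc) h) (sym (sumOver-tabulate suc (h ∘ f))))

sumOver-allFin-suc : (N : ℕ) (h : Fin (suc N) → ℚ) → sumOver (allFinL (suc N)) h ≡ h zero + sumOver (allFinL N) (h ∘ suc)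
sumOver-allFin-suc N h = cong (h zero +_) (sumOver-tabulate suc h)

sumOver-indicator : (N d : ℕ) → d < N → (c : ℕ → ℚ) →
  sumOver (allFinL N) (λ i → c (toℕ i) * 𝟙 (does (d ≟ toℕ i))) ≡ c d
sumOver-indicator (suc N) zero _ c = begin
  _ ≡⟨ sumOver-allFin-suc N (λ i → c (toℕ i) * 𝟙 (does (0 ≟ toℕ i))) ⟩
  c 0 * 1ℚ + sumOver (allFinL N) (λ i → c (suc (toℕ i)) * 0ℚ)
    ≡⟨ cong₂ _+_ (ℚ.*-identityʳ (c 0)) (sumOver-zero (allFinL N) (λ i → ℚ.*-zeroʳ (c (suc (toℕ i))))) ⟩
  c 0 + 0ℚ ≡⟨ ℚ.+-identityʳ (c 0) ⟩
  c 0      ∎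
sumOver-indicator (suc N) (suc d) (s≤s d<N) c = begin
  _ ≡⟨ sumOver-allFin-suc N (λ i → c (toℕ i) * 𝟙 (does (suc d ≟ toℕ i))) ⟩
  c 0 * 0ℚ + sumOver (allFinL N) (λ i → c (suc (toℕ i)) * 𝟙 (does (d ≟ toℕ i)))
    ≡⟨ cong₂ _+_ (ℚ.*-zeroʳ (c 0)) (sumOver-indicator N d d<N (c ∘ suc)) ⟩
  0ℚ + c (suc d) ≡⟨ ℚ.+-identityˡ _ ⟩
  c (suc d)      ∎

FactorsThrough : {A : Set} → (A → ℕ) → (A → ℚ) → Set
FactorsThrough s v = Σ (ℕ → ℚ) λ g → ∀ a → v a ≡ g (s a)

module LevelSets {A : Set} (N : ℕ) (s : A → ℕ) (e : Fin N → A → ℚ)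
                 (e-apply : ∀ i a → e i a ≡ 𝟙 (does (s a ≟ toℕ i))) where

  inSpan⇒factorsThrough : {v : A → ℚ} → InSpan N e v → FactorsThrough s v
  inSpan⇒factorsThrough (c , v≗) =
    (λ d → sumOver (allFinL N) (λ i → c i * 𝟙 (does (d ≟ toℕ i)))) ,
    λ a → trans (v≗ a) (sumOver-cong (allFinL N) (λ i → cong (c i *_) (e-apply i a)))

  module _ (s<N : ∀ a → s a < N) where

    factorsThrough⇒inSpan : {v : A → ℚ} → FactorsThrough s v → InSpan N e v
    factorsThrough⇒inSpan {v} (g , v≗) = g ∘ toℕ , λ a → begin
      v a
        ≡⟨ v≗ a ⟩
      g (s a)
        ≡⟨ sumOver-indicator N (s a) (s<N a) g ⟨
      sumOver (allFinL N) (λ i → g (toℕ i) * 𝟙 (does (s a ≟ toℕ i)))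
        ≡⟨ sumOver-cong (allFinL N) (λ i → cong (g (toℕ i) *_) (e-apply i a)) ⟨
      sumOver (allFinL N) (λ i → g (toℕ i) * e i a) ∎

    sumOver-levels : ∀ a → sumOver (allFinL N) (λ i → e i a) ≡ 1ℚ
    sumOver-levels a = trans (sumOver-cong (allFinL N) (λ i → trans (e-apply i a) (sym (ℚ.*-identityˡ _))))
                             (sumOver-indicator N (s a) (s<N a) (λ _ → 1ℚ))

-- Type B: the span of the X_J and β²

des : {m : ℕ} → SPerm m → ℕ
des w = ∣ Des w ∣

Y-apply : {m : ℕ} (J : Subset m) (w : SPerm m) → Y J w ≡ 𝟙 (does (Des w ≟S J))
Y-apply J w = cong 𝟙 (isYes≗does (Des w ≟S J))

sumOver-Y : {m : ℕ} {P : Subset m → Set} (P? : ∀ J → Dec (P J)) (w : SPerm m) →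
  sumOver (filter P? (allSubsets m)) (λ J → Y J w) ≡ 𝟙 (does (P? (Des w)))
sumOver-Y {m} P? w = begin
  sumOver (filter P? (allSubsets m)) (λ J → Y J w) ≡⟨ sumOver-filter P? (allSubsets m) (λ J → Y J w) ⟩
  sumOver (allSubsets m) restricted                 ≡⟨ sumOver-allSubsets-single m (Des w) restricted off ⟩
  restricted (Des w)                                ≡⟨ cong (if does (P? (Des w)) then_else 0ℚ) on ⟩
  𝟙 (does (P? (Des w)))                             ∎
  where
  restricted : Subset m → ℚ
  restricted J = if does (P? J) then Y J w else 0ℚ
  on : Y (Des w) w ≡ 1ℚ
  on = trans (Y-apply (Des w) w) (cong 𝟙 (dec-true (Des w ≟S Des w) refl))
  off : ∀ J → Des w ≢ J → restricted J ≡ 0ℚ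
  off J Des≢J = trans (cong (if does (P? J) then_else 0ℚ) (trans (Y-apply J w) (cong 𝟙 (dec-false (Des w ≟S J) Des≢J))))
                      (if-zero (does (P? J)))

X-apply : {m : ℕ} (J : Subset m) (w : SPerm m) → X J w ≡ 𝟙 (does (Des w ⊆? J))
X-apply J = sumOver-Y (_⊆? J)

yB-apply : (m j : ℕ) (w : SPerm m) → yB m j w ≡ 𝟙 (does (des w ≟ j))
yB-apply m j = sumOver-Y (λ J → ∣ J ∣ ≟ j)

module SolLevels (m : ℕ) = LevelSets (suc m) des (λ i → yB m (toℕ i)) (λ i → yB-apply m (toℕ i))

InSol⇒factorsThrough : {m : ℕ} {v : QB m} → InSol m v → FactorsThrough des v
InSol⇒factorsThrough {m} = SolLevels.inSpan⇒factorsThrough m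

factorsThrough⇒InSol : {m : ℕ} {v : QB m} → FactorsThrough des v → InSol m v
factorsThrough⇒InSol {m} = SolLevels.factorsThrough⇒inSpan m (λ w → s≤s (∣p∣≤n (Des w)))

-- upperSum a D = Σ_{J ⊇ D} a J
upperSum : {m : ℕ} → (Subset m → ℚ) → Subset m → ℚ
upperSum {zero}  a []          = a []
upperSum {suc m} a (false ∷ D) = upperSum (a ∘ (false ∷_)) D + upperSum (a ∘ (true ∷_)) D
upperSum {suc m} a (true ∷ D)  = upperSum (a ∘ (true ∷_)) D

sumOver-supersets : (m : ℕ) (a : Subset m → ℚ) (D : Subset m) →
  sumOver (allSubsets m) (λ J → a J * 𝟙 (does (D ⊆? J))) ≡ upperSum a D
sumOver-supersets zero    a []          = trans (ℚ.+-identityʳ _) (ℚ.*-identityʳ (a []))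
sumOver-supersets (suc m) a (false ∷ D) =
  trans (sumOver-allSubsets-suc m (λ J → a J * 𝟙 (does ((false ∷ D) ⊆? J))))
        (cong₂ _+_ (sumOver-supersets m (a ∘ (false ∷_)) D) (sumOver-supersets m (a ∘ (true ∷_)) D))
sumOver-supersets (suc m) a (true ∷ D)  = begin
  sumOver (allSubsets (suc m)) (λ J → a J * 𝟙 (does ((true ∷ D) ⊆? J)))
    ≡⟨ sumOver-allSubsets-suc m (λ J → a J * 𝟙 (does ((true ∷ D) ⊆? J))) ⟩
  sumOver (allSubsets m) (λ J → a (false ∷ J) * 0ℚ) + sumOver (allSubsets m) (λ J → a (true ∷ J) * 𝟙 (does (D ⊆? J)))
    ≡⟨ cong₂ _+_ (sumOver-zero (allSubsets m) (λ J → ℚ.*-zeroʳ (a (false ∷ J))))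
                 (sumOver-supersets m (a ∘ (true ∷_)) D) ⟩
  0ℚ + upperSum (a ∘ (true ∷_)) D
    ≡⟨ ℚ.+-identityˡ _ ⟩
  upperSum (a ∘ (true ∷_)) D ∎

XSpan-apply : {m : ℕ} (a : Subset m → ℚ) (w : SPerm m) →
  ⅀ (allSubsets m) (λ J w → a J * X J w) w ≡ upperSum a (Des w)
XSpan-apply {m} a w =
  trans (sumOver-cong (allSubsets m) (λ J → cong (a J *_) (X-apply J w))) (sumOver-supersets m a (Des w))

möbius : {m : ℕ} → (Subset m → ℚ) → Subset m → ℚ
möbius {zero}  f []          = f []
möbius {suc m} f (false ∷ J) = möbius (λ D → f (false ∷ D) - f (true ∷ D)) J
möbius {suc m} f (true ∷ J)  = möbius (f ∘ (true ∷_)) J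

upperSum-möbius : {m : ℕ} (f : Subset m → ℚ) (D : Subset m) → upperSum (möbius f) D ≡ f D
upperSum-möbius {zero}  f []          = refl
upperSum-möbius {suc m} f (true ∷ D)  = upperSum-möbius (f ∘ (true ∷_)) D
upperSum-möbius {suc m} f (false ∷ D) = begin
  upperSum (möbius (λ J → f (false ∷ J) - f (true ∷ J))) D + upperSum (möbius (f ∘ (true ∷_))) D
    ≡⟨ cong₂ _+_ (upperSum-möbius (λ J → f (false ∷ J) - f (true ∷ J)) D) (upperSum-möbius (f ∘ (true ∷_)) D) ⟩
  f (false ∷ D) - f (true ∷ D) + f (true ∷ D)
    ≡⟨ solve 2 (λ x y → x :- y :+ y := x) refl (f (false ∷ D)) (f (true ∷ D)) ⟩
  f (false ∷ D) ∎

∂² : {k : ℕ} → (Subset (suc (suc k)) → ℚ) → Subset k → ℚ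
∂² f D = f (false ∷ false ∷ D) - f (true ∷ false ∷ D) - f (false ∷ true ∷ D) + f (true ∷ true ∷ D)

∂²-cong : {k : ℕ} {f f′ : Subset (suc (suc k)) → ℚ} → (∀ D → f D ≡ f′ D) → ∀ D → ∂² f D ≡ ∂² f′ D
∂²-cong {f = f} {f′} f≗f′ D =
  cong₂ _+_ (cong₂ _-_ (cong₂ _-_ (f≗f′ (false ∷ false ∷ D)) (f≗f′ (true ∷ false ∷ D)))
                      (f≗f′ (false ∷ true ∷ D)))
            (f≗f′ (true ∷ true ∷ D))

upperSum-∂² : {k : ℕ} (a : Subset (suc (suc k)) → ℚ) (D : Subset k) →
  upperSum (λ J → a (false ∷ false ∷ J)) D ≡ ∂² (upperSum a) D
upperSum-∂² a D =
  solve 4 (λ ff ft tf tt → ff := (ff :+ ft :+ (tf :+ tt)) :- (tf :+ tt) :- (ft :+ tt) :+ tt) refl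
    (upperSum (λ J → a (false ∷ false ∷ J)) D) (upperSum (λ J → a (false ∷ true ∷ J)) D)
    (upperSum (λ J → a (true ∷ false ∷ J)) D) (upperSum (λ J → a (true ∷ true ∷ J)) D)

signed : Bool → ℕ → ℤ
signed false a = ℤ.+ a
signed true  a = -ℤ (ℤ.+ a)

signed≤+ : ∀ e a → signed e a ≤ℤ ℤ.+ a
signed≤+ false a       = ℤ.≤-refl
signed≤+ true  zero    = ℤ.≤-refl
signed≤+ true  (suc a) = ℤ.-≤+

-≤signed : ∀ e a → -ℤ (ℤ.+ a) ≤ℤ signed e a
-≤signed false a = ℤ.neg-≤-pos
-≤signed true  a = ℤ.≤-refl

-- Comparing entries of different absolute values only depends on one sign: the sign of the
-- later entry at an ascent of absolute values, the sign of the earlier one at a descent.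
descent-at-ascent : ∀ {a a′} → a < a′ → ∀ e e′ → does (signed e′ a′ ℤ.<? signed e a) ≡ e′
descent-at-ascent {a} {a′} a<a′ e false =
  dec-false (ℤ.+ a′ ℤ.<? signed e a) (λ lt → ℤ.<-asym (ℤ.<-≤-trans lt (signed≤+ e a)) (ℤ.+<+ a<a′))
descent-at-ascent {a} {a′} a<a′ e true  =
  dec-true (-ℤ (ℤ.+ a′) ℤ.<? signed e a) (ℤ.<-≤-trans (ℤ.neg-mono-< (ℤ.+<+ a<a′)) (-≤signed e a))

descent-at-descent : ∀ {a a′} → a′ < a → ∀ e e′ → does (signed e′ a′ ℤ.<? signed e a) ≡ not e
descent-at-descent {a} {a′} a′<a false e′ =
  dec-true (signed e′ a′ ℤ.<? ℤ.+ a) (ℤ.≤-<-trans (signed≤+ e′ a′) (ℤ.+<+ a′<a))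
descent-at-descent {a} {a′} a′<a true  e′ =
  dec-false (signed e′ a′ ℤ.<? -ℤ (ℤ.+ a))
            (λ lt → ℤ.<-asym lt (ℤ.<-≤-trans (ℤ.neg-mono-< (ℤ.+<+ a′<a)) (-≤signed e′ a′)))

desVec-∷ : {m : ℕ} (x y : ℤ) (r : Vec ℤ m) → desVec (x ∷ y ∷ r) ≡ does (y ℤ.<? x) ∷ desVec (y ∷ r)
desVec-∷ x y r = cong (_∷ desVec (y ∷ r)) (isYes≗does (y ℤ.<? x))

entryB-signed : {m : ℕ} (w : SPerm m) (i : Fin m) → entryB w i ≡ signed (lookup (proj₂ w) i) (suc (toℕ (proj₁ w ⟨$⟩ʳ i)))
entryB-signed (σ , s) i with lookup s i
... | true  = refl
... | false = refl

signWord : {L : ℕ} → Vec ℕ L → Subset L → Vec ℤ L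
signWord []       []      = []
signWord (a ∷ as) (e ∷ s) = signed e a ∷ signWord as s

tabulate-signed : {m : ℕ} (f : Fin m → ℕ) (s : Subset m) → tabulate (λ i → signed (lookup s i) (f i)) ≡ signWord (tabulate f) s
tabulate-signed f []      = refl
tabulate-signed f (e ∷ s) = cong (signed e (f zero) ∷_) (tabulate-signed (f ∘ suc) s)

Des-signWord : {m : ℕ} (σ : Permutation′ m) (s : Subset m) → Des (σ , s) ≡ desVec (0ℤ ∷ signWord (tabulate (entryA σ)) s)
Des-signWord σ s = cong (λ r → desVec (0ℤ ∷ r)) (trans (Vec.tabulate-cong (entryB-signed (σ , s))) (tabulate-signed (entryA σ) s))

counting : {m : ℕ} → ℕ → Vec ℕ m
counting c = tabulate (λ i → suc (c ℕ.+ toℕ i))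

counting-suc : {m : ℕ} (c : ℕ) → counting {suc m} c ≡ suc c ∷ counting (suc c)
counting-suc c = cong₂ _∷_ (cong suc (ℕₚ.+-identityʳ c)) (Vec.tabulate-cong (λ i → cong suc (ℕₚ.+-suc c (toℕ i))))

desVec-signedCounting : {m : ℕ} (c : ℕ) (e : Bool) (D : Subset m) → desVec (signed e c ∷ signWord (counting c) D) ≡ D
desVec-signedCounting {zero}  c e []      = refl
desVec-signedCounting {suc m} c e (d ∷ D) = begin
  desVec (signed e c ∷ signWord (counting c) (d ∷ D))
    ≡⟨ cong (λ a → desVec (signed e c ∷ signWord a (d ∷ D))) (counting-suc c) ⟩
  desVec (signed e c ∷ signed d (suc c) ∷ signWord (counting (suc c)) D)
    ≡⟨ desVec-∷ (signed e c) (signed d (suc c)) (signWord (counting (suc c)) D) ⟩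
  does (signed d (suc c) ℤ.<? signed e c) ∷ desVec (signed d (suc c) ∷ signWord (counting (suc c)) D)
    ≡⟨ cong₂ _∷_ (descent-at-ascent (ℕₚ.n<1+n c) e d) (desVec-signedCounting (suc c) d D) ⟩
  d ∷ D ∎

ι : {m : ℕ} → Subset m → SPerm m
ι D = Perm.id , D

Des-ι : {m : ℕ} (D : Subset m) → Des (ι D) ≡ D
Des-ι D = trans (Des-signWord Perm.id D) (desVec-signedCounting 0 false D)

Beta2-apply : {k : ℕ} {v : QB (suc (suc k))} {u : QB k} → Beta2 k v u → ∀ w → u w ≡ ∂² (v ∘ ι) (Des w)
Beta2-apply {v = v} {u} (a , v≗ , u≗) w = begin
  u w                                          ≡⟨ trans (u≗ w) (XSpan-apply (λ J → a (false ∷ false ∷ J)) w) ⟩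
  upperSum (λ J → a (false ∷ false ∷ J)) (Des w) ≡⟨ upperSum-∂² a (Des w) ⟩
  ∂² (upperSum a) (Des w)                      ≡⟨ ∂²-cong v∘ι≗ (Des w) ⟨
  ∂² (v ∘ ι) (Des w)                           ∎
  where
  v∘ι≗ : ∀ D → v (ι D) ≡ upperSum a D
  v∘ι≗ D = trans (trans (v≗ (ι D)) (XSpan-apply a (ι D))) (cong (upperSum a) (Des-ι D))

Beta2-intro : {k : ℕ} {v : QB (suc (suc k))} (f : Subset (suc (suc k)) → ℚ) →
  (∀ w → v w ≡ f (Des w)) → Beta2 k v (λ w → ∂² f (Des w))
Beta2-intro {k} {v} f v≗ = möbius f , v≗X , u≗X
  where
  v≗X : ∀ w → v w ≡ ⅀ (allSubsets (suc (suc k))) (λ J w → möbius f J * X J w) w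
  v≗X w = trans (v≗ w) (sym (trans (XSpan-apply (möbius f) w) (upperSum-möbius f (Des w))))
  u≗X : ∀ w → ∂² f (Des w) ≡ ⅀ (allSubsets k) (λ J w → möbius f (false ∷ false ∷ J) * X J w) w
  u≗X w = begin
    ∂² f (Des w)                                         ≡⟨ ∂²-cong (upperSum-möbius f) (Des w) ⟨
    ∂² (upperSum (möbius f)) (Des w)                     ≡⟨ upperSum-∂² (möbius f) (Des w) ⟨
    upperSum (λ J → möbius f (false ∷ false ∷ J)) (Des w) ≡⟨ XSpan-apply (λ J → möbius f (false ∷ false ∷ J)) w ⟨
    ⅀ (allSubsets k) (λ J w → möbius f (false ∷ false ∷ J) * X J w) w ∎

Beta2-resp : {k : ℕ} {v : QB (suc (suc k))} {u u′ : QB k} → Beta2 k v u → u′ ≗ℚ u → Beta2 k v u′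
Beta2-resp (a , v≗ , u≗) u′≗u = a , v≗ , λ w → trans (u′≗u w) (u≗ w)

Δ² : (ℕ → ℚ) → ℕ → ℚ
Δ² g d = g d - g (suc d) - g (suc d) + g (suc (suc d))

Beta2-desFunction : {k : ℕ} {v : QB (suc (suc k))} (g : ℕ → ℚ) →
  (∀ w → v w ≡ g (des w)) → Beta2 k v (λ w → Δ² g (des w))
Beta2-desFunction g = Beta2-intro (g ∘ ∣_∣)

Beta2-desFunction-apply : {k : ℕ} {v : QB (suc (suc k))} {u : QB k} (g : ℕ → ℚ) →
  Beta2 k v u → (∀ w → v w ≡ g (des w)) → ∀ w → u w ≡ Δ² g (des w)
Beta2-desFunction-apply g β v≗ w =
  trans (Beta2-apply β w) (∂²-cong (λ D → trans (v≗ (ι D)) (cong (g ∘ ∣_∣) (Des-ι D))) (Des w))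

sizeIs : {m : ℕ} → ℕ → Subset m → ℚ
sizeIs j J = 𝟙 (does (∣ J ∣ ≟ j))

xB-apply : (m j : ℕ) (w : SPerm m) → xB m j w ≡ upperSum (sizeIs j) (Des w)
xB-apply m j w = begin
  sumOver (filter (λ J → ∣ J ∣ ≟ j) (allSubsets m)) (λ J → X J w)
    ≡⟨ sumOver-filter (λ J → ∣ J ∣ ≟ j) (allSubsets m) (λ J → X J w) ⟩
  sumOver (allSubsets m) (λ J → if does (∣ J ∣ ≟ j) then X J w else 0ℚ)
    ≡⟨ sumOver-cong (allSubsets m) (λ J → if≡𝟙* (does (∣ J ∣ ≟ j)) (X J w)) ⟩
  sumOver (allSubsets m) (λ J → sizeIs j J * X J w)
    ≡⟨ XSpan-apply (sizeIs j) w ⟩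
  upperSum (sizeIs j) (Des w) ∎

upperSum-sizeIs-large : (m j : ℕ) (D : Subset m) → m < j → upperSum (sizeIs j) D ≡ 0ℚ
upperSum-sizeIs-large zero    (suc j) []          _         = refl
upperSum-sizeIs-large (suc m) (suc j) (false ∷ D) (s≤s m<j) =
  trans (cong₂ _+_ (upperSum-sizeIs-large m (suc j) D (ℕₚ.m≤n⇒m≤1+n m<j)) (upperSum-sizeIs-large m j D m<j))
        (ℚ.+-identityʳ 0ℚ)
upperSum-sizeIs-large (suc m) (suc j) (true ∷ D)  (s≤s m<j) = upperSum-sizeIs-large m j D m<j

upperSum-sizeIs-full : (m : ℕ) (D : Subset m) → upperSum (sizeIs m) D ≡ 1ℚ
upperSum-sizeIs-full zero    []          = refl
upperSum-sizeIs-full (suc m) (false ∷ D) =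
  trans (cong₂ _+_ (upperSum-sizeIs-large m (suc m) D (ℕₚ.n<1+n m)) (upperSum-sizeIs-full m D)) (ℚ.+-identityˡ 1ℚ)
upperSum-sizeIs-full (suc m) (true ∷ D)  = upperSum-sizeIs-full m D

upperSum-sizeIs-corank1 : (m : ℕ) (D : Subset (suc m)) → upperSum (sizeIs m) D ≡ suc m · 1ℚ - ∣ D ∣ · 1ℚ
upperSum-sizeIs-corank1 zero    (false ∷ []) = refl
upperSum-sizeIs-corank1 zero    (true ∷ [])  = refl
upperSum-sizeIs-corank1 (suc m) (false ∷ D)  = begin
  upperSum (sizeIs (suc m)) D + upperSum (sizeIs m) D
    ≡⟨ cong₂ _+_ (upperSum-sizeIs-full (suc m) D) (upperSum-sizeIs-corank1 m D) ⟩
  1ℚ + (suc m · 1ℚ - ∣ D ∣ · 1ℚ)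
    ≡⟨ solve 2 (λ n d → con 1ℚ :+ (n :- d) := con 1ℚ :+ n :- d) refl (suc m · 1ℚ) (∣ D ∣ · 1ℚ) ⟩
  suc (suc m) · 1ℚ - ∣ D ∣ · 1ℚ ∎
upperSum-sizeIs-corank1 (suc m) (true ∷ D)   = begin
  upperSum (sizeIs m) D
    ≡⟨ upperSum-sizeIs-corank1 m D ⟩
  suc m · 1ℚ - ∣ D ∣ · 1ℚ
    ≡⟨ solve 2 (λ n d → n :- d := con 1ℚ :+ n :- (con 1ℚ :+ d)) refl (suc m · 1ℚ) (∣ D ∣ · 1ℚ) ⟩
  suc (suc m) · 1ℚ - suc ∣ D ∣ · 1ℚ ∎

xCombination : ℕ → (Fin 2 → ℚ) → ℕ → ℚ
xCombination k c d = c zero * 1ℚ + (c (suc zero) * (suc (suc k) · 1ℚ - d · 1ℚ) + 0ℚ)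

InX-apply : (k : ℕ) (c : Fin 2 → ℚ) (w : SPerm (suc (suc k))) →
  ⅀ (allFinL 2) (λ i a → c i * xTop k i a) w ≡ xCombination k c (des w)
InX-apply k c w =
  cong₂ _+_ (cong (c zero *_) (trans (xB-apply (suc (suc k)) (suc (suc k)) w) (upperSum-sizeIs-full (suc (suc k)) (Des w))))
            (cong (_+ 0ℚ) (cong (c (suc zero) *_) (trans (xB-apply (suc (suc k)) (suc k) w) (upperSum-sizeIs-corank1 (suc k) (Des w)))))

Δ²-xCombination : (k : ℕ) (c : Fin 2 → ℚ) (d : ℕ) → Δ² (xCombination k c) d ≡ 0ℚ
Δ²-xCombination k c d =
  solve 4 (λ c₀ c₁ n x →
      (c₀ :* con 1ℚ :+ (c₁ :* (n :- x) :+ con 0ℚ))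
    :- (c₀ :* con 1ℚ :+ (c₁ :* (n :- (con 1ℚ :+ x)) :+ con 0ℚ))
    :- (c₀ :* con 1ℚ :+ (c₁ :* (n :- (con 1ℚ :+ x)) :+ con 0ℚ))
    :+ (c₀ :* con 1ℚ :+ (c₁ :* (n :- (con 1ℚ :+ (con 1ℚ :+ x))) :+ con 0ℚ)) := con 0ℚ)
    refl (c zero) (c (suc zero)) (suc (suc k) · 1ℚ) (d · 1ℚ)

affine-of-Δ²≡0 : (k : ℕ) (g : ℕ → ℚ) → (∀ d → d ≤ k → Δ² g d ≡ 0ℚ) →
  ∀ d → d ≤ suc (suc k) → g d ≡ g 0 + d · 1ℚ * (g 1 - g 0)
affine-of-Δ²≡0 k g Δ²g≡0 zero          _ =
  solve 2 (λ g₀ g₁ → g₀ := g₀ :+ con 0ℚ :* (g₁ :- g₀)) refl (g 0) (g 1)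
affine-of-Δ²≡0 k g Δ²g≡0 (suc zero)    _ =
  solve 2 (λ g₀ g₁ → g₁ := g₀ :+ (con 1ℚ :+ con 0ℚ) :* (g₁ :- g₀)) refl (g 0) (g 1)
affine-of-Δ²≡0 k g Δ²g≡0 (suc (suc d)) (s≤s (s≤s d≤k)) = begin
  g (2 ℕ.+ d)
    ≡⟨ solve 3 (λ x y z → z := (x :- y :- y :+ z) :- x :+ y :+ y) refl (g d) (g (1 ℕ.+ d)) (g (2 ℕ.+ d)) ⟩
  Δ² g d - g d + g (1 ℕ.+ d) + g (1 ℕ.+ d)
    ≡⟨ cong₂ (λ δ x → δ - x + g (1 ℕ.+ d) + g (1 ℕ.+ d))
             (Δ²g≡0 d d≤k) (affine-of-Δ²≡0 k g Δ²g≡0 d (ℕₚ.m≤n⇒m≤1+n (ℕₚ.m≤n⇒m≤1+n d≤k))) ⟩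
  0ℚ - (g 0 + d · 1ℚ * (g 1 - g 0)) + g (1 ℕ.+ d) + g (1 ℕ.+ d)
    ≡⟨ cong (λ y → 0ℚ - (g 0 + d · 1ℚ * (g 1 - g 0)) + y + y)
            (affine-of-Δ²≡0 k g Δ²g≡0 (suc d) (s≤s (ℕₚ.m≤n⇒m≤1+n d≤k))) ⟩
  0ℚ - (g 0 + d · 1ℚ * (g 1 - g 0)) + (g 0 + suc d · 1ℚ * (g 1 - g 0)) + (g 0 + suc d · 1ℚ * (g 1 - g 0))
    ≡⟨ solve 3 (λ g₀ g₁ x → con 0ℚ :- (g₀ :+ x :* (g₁ :- g₀))
                              :+ (g₀ :+ (con 1ℚ :+ x) :* (g₁ :- g₀)) :+ (g₀ :+ (con 1ℚ :+ x) :* (g₁ :- g₀))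
                            := g₀ :+ (con 1ℚ :+ (con 1ℚ :+ x)) :* (g₁ :- g₀)) refl (g 0) (g 1) (d · 1ℚ) ⟩
  g 0 + suc (suc d) · 1ℚ * (g 1 - g 0) ∎

subsetOfSize : (k d : ℕ) → d ≤ k → Σ (Subset k) λ D → ∣ D ∣ ≡ d
subsetOfSize zero    zero    z≤n       = [] , refl
subsetOfSize (suc k) zero    z≤n       = let D , ∣D∣≡0 = subsetOfSize k zero z≤n in false ∷ D , ∣D∣≡0
subsetOfSize (suc k) (suc d) (s≤s d≤k) = let D , ∣D∣≡d = subsetOfSize k d d≤k in true ∷ D , cong suc ∣D∣≡d

secondAntidifference : (ℕ → ℚ) → ℕ → ℚ
secondAntidifference h zero          = 0ℚ
secondAntidifference h (suc zero)    = 0ℚ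
secondAntidifference h (suc (suc d)) =
  h d - secondAntidifference h d + secondAntidifference h (suc d) + secondAntidifference h (suc d)

Δ²-secondAntidifference : (h : ℕ → ℚ) (d : ℕ) → Δ² (secondAntidifference h) d ≡ h d
Δ²-secondAntidifference h d =
  solve 3 (λ x y z → x :- y :- y :+ (z :- x :+ y :+ y) := z) refl
    (secondAntidifference h d) (secondAntidifference h (suc d)) (h d)

InX⇒InSol : (k : ℕ) (v : QB (suc (suc k))) → InX k v → InSol (suc (suc k)) v
InX⇒InSol k v (c , v≗) = factorsThrough⇒InSol (xCombination k c , λ w → trans (v≗ w) (InX-apply k c w))

Beta2-exists : (k : ℕ) (v : QB (suc (suc k))) → InSol (suc (suc k)) v → Σ (QB k) λ u → Beta2 k v u
Beta2-exists k v sol = let g , v≗ = InSol⇒factorsThrough sol in (λ w → Δ² g (des w)) , Beta2-desFunction g v≗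

Beta2-functional : {k : ℕ} {v : QB (suc (suc k))} {u u′ : QB k} → Beta2 k v u → Beta2 k v u′ → u ≗ℚ u′
Beta2-functional β β′ w = trans (Beta2-apply β w) (sym (Beta2-apply β′ w))

Beta2-preserves-Sol : (k : ℕ) (v : QB (suc (suc k))) (u : QB k) → InSol (suc (suc k)) v → Beta2 k v u → InSol k u
Beta2-preserves-Sol k v u sol β =
  let g , v≗ = InSol⇒factorsThrough sol in factorsThrough⇒InSol (Δ² g , Beta2-desFunction-apply g β v≗)

Beta2-onto-Sol : (k : ℕ) (u : QB k) → InSol k u → Σ (QB (suc (suc k))) λ v → InSol (suc (suc k)) v × Beta2 k v u
Beta2-onto-Sol k u sol with InSol⇒factorsThrough sol
... | h , u≗ = secondAntidifference h ∘ des , factorsThrough⇒InSol (secondAntidifference h , λ _ → refl) ,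
  Beta2-resp (Beta2-desFunction (secondAntidifference h) (λ _ → refl))
             (λ w → trans (u≗ w) (sym (Δ²-secondAntidifference h (des w))))

Beta2-kernel⇒InX : (k : ℕ) (v : QB (suc (suc k))) → InSol (suc (suc k)) v → Beta2 k v zeroV → InX k v
Beta2-kernel⇒InX k v sol β with InSol⇒factorsThrough sol
... | g , v≗ = c , λ w → begin
  v w                                        ≡⟨ v≗ w ⟩
  g (des w)                                  ≡⟨ affine-of-Δ²≡0 k g Δ²g≡0 (des w) (∣p∣≤n (Des w)) ⟩
  g 0 + des w · 1ℚ * (g 1 - g 0)             ≡⟨ affine≡xCombination (g 0) (g 1) (suc (suc k) · 1ℚ) (des w · 1ℚ) ⟩
  xCombination k c (des w)                   ≡⟨ InX-apply k c w ⟨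
  ⅀ (allFinL 2) (λ i a → c i * xTop k i a) w ∎
  where
  c : Fin 2 → ℚ
  c zero    = g 0 + suc (suc k) · 1ℚ * (g 1 - g 0)
  c (suc _) = g 0 - g 1
  affine≡xCombination : ∀ g₀ g₁ n x →
    g₀ + x * (g₁ - g₀) ≡ (g₀ + n * (g₁ - g₀)) * 1ℚ + ((g₀ - g₁) * (n - x) + 0ℚ)
  affine≡xCombination = solve 4 (λ g₀ g₁ n x →
    g₀ :+ x :* (g₁ :- g₀) := (g₀ :+ n :* (g₁ :- g₀)) :* con 1ℚ :+ ((g₀ :- g₁) :* (n :- x) :+ con 0ℚ)) refl
  Δ²g≡0 : ∀ d → d ≤ k → Δ² g d ≡ 0ℚ
  Δ²g≡0 d d≤k = let D , ∣D∣≡d = subsetOfSize k d d≤k in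
    trans (cong (Δ² g) (sym (trans (cong ∣_∣ (Des-ι D)) ∣D∣≡d))) (sym (Beta2-desFunction-apply g β v≗ (ι D)))

InX⇒Beta2-kernel : (k : ℕ) (v : QB (suc (suc k))) → InX k v → Beta2 k v zeroV
InX⇒Beta2-kernel k v (c , v≗) =
  Beta2-resp (Beta2-desFunction (xCombination k c) (λ w → trans (v≗ w) (InX-apply k c w)))
             (λ w → sym (Δ²-xCombination k c (des w)))

-- Type A: peak sets and π

pk : {m : ℕ} → Permutation′ m → ℕ
pk σ = ∣ Peak σ ∣

no-adjacent-peaks : ∀ a b c d → not ((⌊ a <? b ⌋ ∧ ⌊ c <? b ⌋) ∧ (⌊ b <? c ⌋ ∧ ⌊ d <? c ⌋)) ≡ true
no-adjacent-peaks a b c d with a <? b | c <? b | b <? c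
... | no _  | _       | _       = refl
... | yes _ | no _    | _       = refl
... | yes _ | yes _   | no _    = refl
... | yes _ | yes c<b | yes b<c = contradiction b<c (ℕₚ.<-asym c<b)

noConsec-peaks3 : (k : ℕ) (w : Vec ℕ (suc (suc k))) → noConsec (peaks3 w) ≡ true
noConsec-peaks3 zero          w                   = refl
noConsec-peaks3 (suc zero)    (a ∷ b ∷ c ∷ [])     = refl
noConsec-peaks3 (suc (suc k)) (a ∷ b ∷ c ∷ d ∷ r) =
  cong₂ _∧_ (no-adjacent-peaks a b c d) (noConsec-peaks3 (suc k) (b ∷ c ∷ d ∷ r))

noConsec-false∷ : {m : ℕ} (R : Vec Bool m) → noConsec R ≡ true → noConsec (false ∷ R) ≡ true
noConsec-false∷ []      _ = refl
noConsec-false∷ (c ∷ R) p = p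

isPeakSet-Peak : {m : ℕ} (σ : Permutation′ m) → isPeakSet (Peak σ) ≡ true
isPeakSet-Peak {zero}  σ = refl
isPeakSet-Peak {suc m} σ = noConsec-false∷ (peaks3 (0 ∷ tabulate (entryA σ))) (noConsec-peaks3 m (0 ∷ tabulate (entryA σ)))

headOr-Peak : {k : ℕ} (τ : Permutation′ k) → headOr (Peak τ) ≡ false
headOr-Peak {zero}  τ = refl
headOr-Peak {suc k} τ = refl

P-apply : {m : ℕ} (F : Subset m) (σ : Permutation′ m) → P F σ ≡ 𝟙 (does (Peak σ ≟S F))
P-apply F σ = cong 𝟙 (isYes≗does (Peak σ ≟S F))

P-on : {m : ℕ} (σ : Permutation′ m) → P (Peak σ) σ ≡ 1ℚ
P-on σ = trans (P-apply (Peak σ) σ) (cong 𝟙 (dec-true (Peak σ ≟S Peak σ) refl))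

P-off : {m : ℕ} {F : Subset m} (σ : Permutation′ m) → Peak σ ≢ F → P F σ ≡ 0ℚ
P-off {F = F} σ Peak≢F = trans (P-apply F σ) (cong 𝟙 (dec-false (Peak σ ≟S F) Peak≢F))

admissibly : {m : ℕ} → Subset m → ℚ → ℚ
admissibly F x = if does (isPeakSet F Bool.≟ true) then x else 0ℚ

admissibly-Peak : {m : ℕ} (σ : Permutation′ m) (x : ℚ) → admissibly (Peak σ) x ≡ x
admissibly-Peak σ x rewrite isPeakSet-Peak σ = refl

sumOver-peakSets : {m : ℕ} (h : Subset m → ℚ) → sumOver (peakSets m) h ≡ sumOver (allSubsets m) (λ F → admissibly F (h F))
sumOver-peakSets {m} = sumOver-filter (λ F → isPeakSet F Bool.≟ true) (allSubsets m)

PeakSpan-apply : {m : ℕ} (b : Subset m → ℚ) (σ : Permutation′ m) →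
  ⅀ (peakSets m) (λ F σ → b F * P F σ) σ ≡ b (Peak σ)
PeakSpan-apply {m} b σ = begin
  sumOver (peakSets m) (λ F → b F * P F σ)                       ≡⟨ sumOver-peakSets (λ F → b F * P F σ) ⟩
  sumOver (allSubsets m) (λ F → admissibly F (b F * P F σ))      ≡⟨ sumOver-allSubsets-single m (Peak σ) _ off ⟩
  admissibly (Peak σ) (b (Peak σ) * P (Peak σ) σ)                ≡⟨ admissibly-Peak σ _ ⟩
  b (Peak σ) * P (Peak σ) σ                                      ≡⟨ cong (b (Peak σ) *_) (P-on σ) ⟩
  b (Peak σ) * 1ℚ                                                ≡⟨ ℚ.*-identityʳ _ ⟩
  b (Peak σ)                                                     ∎
  where
  off : ∀ F → Peak σ ≢ F → admissibly F (b F * P F σ) ≡ 0ℚ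
  off F Peak≢F = trans (cong (admissibly F) (trans (cong (b F *_) (P-off σ Peak≢F)) (ℚ.*-zeroʳ (b F))))
                       (if-zero (does (isPeakSet F Bool.≟ true)))

<?-shift : ∀ a b → ⌊ 2 ℕ.+ a <? 2 ℕ.+ b ⌋ ≡ ⌊ a <? b ⌋
<?-shift a b = trans (isYes≗does (2 ℕ.+ a <? 2 ℕ.+ b)) (sym (isYes≗does (a <? b)))

peaks3-shift : (k : ℕ) (w : Vec ℕ (suc (suc k))) → peaks3 (Vec.map (2 ℕ.+_) w) ≡ peaks3 w
peaks3-shift zero    w               = refl
peaks3-shift (suc k) (a ∷ b ∷ c ∷ r) =
  cong₂ _∷_ (cong₂ _∧_ (<?-shift a b) (<?-shift c b)) (peaks3-shift k (b ∷ c ∷ r))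

peaks3-lowerStart : (k : ℕ) {a : ℕ} → a ≤ 2 → (y : ℕ) (T : Vec ℕ k) →
  peaks3 (a ∷ Vec.map (2 ℕ.+_) (suc y ∷ T)) ≡ peaks3 (0 ∷ suc y ∷ T)
peaks3-lowerStart zero    a≤2 y []      = refl
peaks3-lowerStart (suc k) {a} a≤2 y (x ∷ T) =
  cong₂ _∷_ (cong₂ _∧_ a<3+y (<?-shift x (suc y))) (peaks3-shift k (suc y ∷ x ∷ T))
  where
  a<3+y : ⌊ a <? 3 ℕ.+ y ⌋ ≡ true
  a<3+y = trans (isYes≗does (a <? 3 ℕ.+ y)) (dec-true (a <? 3 ℕ.+ y) (s≤s (ℕₚ.≤-trans a≤2 (ℕₚ.m≤m+n 2 y))))

-- In one-line notation lift₀ (lift₀ τ) = 1 2 (τ+2) and swap τ = 2 1 (τ+2).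
Peak-lift₀² : {k : ℕ} (τ : Permutation′ k) → Peak (lift₀ (lift₀ τ)) ≡ false ∷ false ∷ Peak τ
Peak-lift₀² {zero}  τ = refl
Peak-lift₀² {suc k} τ = cong (λ r → false ∷ false ∷ false ∷ r)
  (trans (cong (λ r → peaks3 (2 ∷ r)) (Vec.tabulate-∘ (2 ℕ.+_) (entryA τ)))
         (peaks3-lowerStart k (s≤s (s≤s z≤n)) (toℕ (τ ⟨$⟩ʳ zero)) (tabulate (entryA τ ∘ suc))))

Peak-swap : {k : ℕ} (τ : Permutation′ k) → Peak (swap τ) ≡ false ∷ true ∷ Peak τ
Peak-swap {zero}  τ = refl
Peak-swap {suc k} τ = cong (λ r → false ∷ true ∷ false ∷ r)
  (trans (cong (λ r → peaks3 (1 ∷ r)) (Vec.tabulate-∘ (2 ℕ.+_) (entryA τ)))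
         (peaks3-lowerStart k (s≤s z≤n) (toℕ (τ ⟨$⟩ʳ zero)) (tabulate (entryA τ ∘ suc))))

pk-lift₀² : {k : ℕ} (τ : Permutation′ k) → pk (lift₀ (lift₀ τ)) ≡ pk τ
pk-lift₀² τ = cong ∣_∣ (Peak-lift₀² τ)

pk-swap : {k : ℕ} (τ : Permutation′ k) → pk (swap τ) ≡ suc (pk τ)
pk-swap τ = cong ∣_∣ (Peak-swap τ)

double-suc-≤ : (p k : ℕ) → suc p ℕ.+ suc p ≤ suc (suc k) → p ℕ.+ p ≤ k
double-suc-≤ p k (s≤s 1+2p≤1+k) = ℕₚ.≤-pred (subst (_≤ suc k) (ℕₚ.+-suc p p) 1+2p≤1+k)

pk-realisable : (k p : ℕ) → p ℕ.+ p ≤ k → Σ (Permutation′ k) λ τ → pk τ ≡ p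
pk-realisable zero          zero    _    = Perm.id , refl
pk-realisable (suc zero)    zero    _    = Perm.id , refl
pk-realisable (suc zero)    (suc p) (s≤s 2p+1≤0) = contradiction (subst (_≤ 0) (ℕₚ.+-suc p p) 2p+1≤0) λ ()
pk-realisable (suc (suc k)) zero    _    =
  let τ , pkτ≡0 = pk-realisable k zero z≤n in lift₀ (lift₀ τ) , trans (pk-lift₀² τ) pkτ≡0
pk-realisable (suc (suc k)) (suc p) 2p≤k =
  let τ , pkτ≡p = pk-realisable k p (double-suc-≤ p k 2p≤k) in swap τ , trans (pk-swap τ) (cong suc pkτ≡p)

piP-on : {k : ℕ} (x y : Bool) (τ : Permutation′ k) → piP (x ∷ y ∷ Peak τ) τ ≡ (if y then - 1ℚ else 1ℚ)
piP-on x y τ rewrite headOr-Peak τ | P-on τ = refl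

piP-off : {k : ℕ} (x y : Bool) {J : Subset k} (τ : Permutation′ k) → Peak τ ≢ J → piP (x ∷ y ∷ J) τ ≡ 0ℚ
piP-off x y {J} τ Peak≢J rewrite P-off τ Peak≢J = vanish (headOr J) y
  where
  vanish : (b c : Bool) → (if b then 0ℚ else (if c then - 0ℚ else 0ℚ)) ≡ 0ℚ
  vanish true  _     = refl
  vanish false true  = refl
  vanish false false = refl

piPSpan-apply : {k : ℕ} (b : Subset (suc (suc k)) → ℚ) (τ : Permutation′ k) →
  ⅀ (peakSets (suc (suc k))) (λ F τ → b F * piP F τ) τ ≡ b (false ∷ false ∷ Peak τ) - b (false ∷ true ∷ Peak τ)
piPSpan-apply {k} b τ = begin
  sumOver (peakSets (suc (suc k))) (λ F → b F * piP F τ)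
    ≡⟨ sumOver-peakSets (λ F → b F * piP F τ) ⟩
  sumOver (allSubsets (suc (suc k))) h
    ≡⟨ sumOver-allSubsets-suc (suc k) h ⟩
  sumOver (allSubsets (suc k)) (h ∘ (false ∷_)) + sumOver (allSubsets (suc k)) (h ∘ (true ∷_))
    ≡⟨ cong₂ _+_ (sumOver-allSubsets-suc k (h ∘ (false ∷_))) (sumOver-zero (allSubsets (suc k)) (λ _ → refl)) ⟩
  sumOver (allSubsets k) (term false) + sumOver (allSubsets k) (term true) + 0ℚ
    ≡⟨ cong (_+ 0ℚ) (cong₂ _+_ (sumOver-allSubsets-single k G (term false) (off false))
                               (sumOver-allSubsets-single k G (term true) (off true))) ⟩
  term false G + term true G + 0ℚ
    ≡⟨ cong (_+ 0ℚ) (cong₂ _+_ (on false {lift₀ (lift₀ τ)} (Peak-lift₀² τ)) (on true {swap τ} (Peak-swap τ))) ⟩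
  b (false ∷ false ∷ G) * 1ℚ + b (false ∷ true ∷ G) * - 1ℚ + 0ℚ
    ≡⟨ solve 2 (λ x y → x :* con 1ℚ :+ y :* (:- con 1ℚ) :+ con 0ℚ := x :- y) refl
               (b (false ∷ false ∷ G)) (b (false ∷ true ∷ G)) ⟩
  b (false ∷ false ∷ G) - b (false ∷ true ∷ G) ∎
  where
  G : Subset k
  G = Peak τ
  h : Subset (suc (suc k)) → ℚ
  h F = admissibly F (b F * piP F τ)
  term : Bool → Subset k → ℚ
  term y J = h (false ∷ y ∷ J)
  off : ∀ y J → G ≢ J → term y J ≡ 0ℚ
  off y J G≢J = begin
    admissibly (false ∷ y ∷ J) (b (false ∷ y ∷ J) * piP (false ∷ y ∷ J) τ)
      ≡⟨ cong (λ x → admissibly (false ∷ y ∷ J) (b (false ∷ y ∷ J) * x)) (piP-off false y τ G≢J) ⟩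
    admissibly (false ∷ y ∷ J) (b (false ∷ y ∷ J) * 0ℚ)
      ≡⟨ cong (admissibly (false ∷ y ∷ J)) (ℚ.*-zeroʳ (b (false ∷ y ∷ J))) ⟩
    admissibly (false ∷ y ∷ J) 0ℚ
      ≡⟨ if-zero (does (isPeakSet (false ∷ y ∷ J) Bool.≟ true)) ⟩
    0ℚ ∎
  on : ∀ y {σ : Permutation′ (suc (suc k))} → Peak σ ≡ false ∷ y ∷ G →
       term y G ≡ b (false ∷ y ∷ G) * (if y then - 1ℚ else 1ℚ)
  on y {σ} Peakσ≡ = begin
    admissibly (false ∷ y ∷ G) (b (false ∷ y ∷ G) * piP (false ∷ y ∷ G) τ)
      ≡⟨ cong (λ F → admissibly F (b (false ∷ y ∷ G) * piP (false ∷ y ∷ G) τ)) Peakσ≡ ⟨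
    admissibly (Peak σ) (b (false ∷ y ∷ G) * piP (false ∷ y ∷ G) τ)
      ≡⟨ admissibly-Peak σ (b (false ∷ y ∷ G) * piP (false ∷ y ∷ G) τ) ⟩
    b (false ∷ y ∷ G) * piP (false ∷ y ∷ G) τ
      ≡⟨ cong (b (false ∷ y ∷ G) *_) (piP-on false y τ) ⟩
    b (false ∷ y ∷ G) * (if y then - 1ℚ else 1ℚ) ∎

Pi-apply : {k : ℕ} {v : QS (suc (suc k))} {u : QS k} → Pi k v u → ∀ τ → u τ ≡ v (lift₀ (lift₀ τ)) - v (swap τ)
Pi-apply {v = v} {u} (b , v≗ , u≗) τ = begin
  u τ                                              ≡⟨ trans (u≗ τ) (piPSpan-apply b τ) ⟩
  b (false ∷ false ∷ Peak τ) - b (false ∷ true ∷ Peak τ)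
    ≡⟨ cong₂ _-_ (v-at (lift₀ (lift₀ τ)) (Peak-lift₀² τ)) (v-at (swap τ) (Peak-swap τ)) ⟨
  v (lift₀ (lift₀ τ)) - v (swap τ)                  ∎
  where
  v-at : ∀ σ {F} → Peak σ ≡ F → v σ ≡ b F
  v-at σ Peakσ≡F = trans (trans (v≗ σ) (PeakSpan-apply b σ)) (cong b Peakσ≡F)

Pi-resp : {k : ℕ} {v : QS (suc (suc k))} {u u′ : QS k} → Pi k v u → u′ ≗ℚ u → Pi k v u′
Pi-resp (b , v≗ , u≗) u′≗u = b , v≗ , λ τ → trans (u′≗u τ) (u≗ τ)

Pi-pkFunction : {k : ℕ} {v : QS (suc (suc k))} (f : ℕ → ℚ) →
  (∀ σ → v σ ≡ f (pk σ)) → Pi k v (λ τ → f (pk τ) - f (suc (pk τ)))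
Pi-pkFunction f v≗ =
  f ∘ ∣_∣ , (λ σ → trans (v≗ σ) (sym (PeakSpan-apply (f ∘ ∣_∣) σ))) , λ τ → sym (piPSpan-apply (f ∘ ∣_∣) τ)

Pi-pkFunction-apply : {k : ℕ} {v : QS (suc (suc k))} {u : QS k} (f : ℕ → ℚ) →
  Pi k v u → (∀ σ → v σ ≡ f (pk σ)) → ∀ τ → u τ ≡ f (pk τ) - f (suc (pk τ))
Pi-pkFunction-apply f π v≗ τ = trans (Pi-apply π τ)
  (cong₂ _-_ (trans (v≗ (lift₀ (lift₀ τ))) (cong f (pk-lift₀² τ))) (trans (v≗ (swap τ)) (cong f (pk-swap τ))))

-- Summing over signs

2ℚ : ℚ
2ℚ = 1ℚ + 1ℚ

-- binomialSum q g = Σᵢ C(q,i) g i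
binomialSum : ℕ → (ℕ → ℚ) → ℚ
binomialSum zero    g = g 0
binomialSum (suc q) g = binomialSum q g + binomialSum q (g ∘ suc)

binomialSum-cong : (q : ℕ) {g h : ℕ → ℚ} → (∀ d → g d ≡ h d) → binomialSum q g ≡ binomialSum q h
binomialSum-cong zero    g≗h = g≗h 0
binomialSum-cong (suc q) g≗h = cong₂ _+_ (binomialSum-cong q g≗h) (binomialSum-cong q (g≗h ∘ suc))

binomialSum-from : (q p : ℕ) (g : ℕ → ℚ) →
  binomialSum (suc q) (λ d → g (p ℕ.+ d)) ≡ binomialSum q (λ d → g (p ℕ.+ d)) + binomialSum q (λ d → g (suc (p ℕ.+ d)))
binomialSum-from q p g = cong (binomialSum q (λ d → g (p ℕ.+ d)) +_) (binomialSum-cong q (λ d → cong g (ℕₚ.+-suc p d)))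

suc-if : Bool → ℕ → ℕ
suc-if true  = suc
suc-if false = λ d → d

∣∷∣ : {m : ℕ} (b : Bool) (D : Subset m) → ∣ b ∷ D ∣ ≡ suc-if b ∣ D ∣
∣∷∣ true  D = refl
∣∷∣ false D = refl

signSum : {L : ℕ} → (ℕ → ℚ) → ℤ → Vec ℕ L → ℚ
signSum {L} g x a = sumOver (allSubsets L) (λ s → g ∣ desVec (x ∷ signWord a s) ∣)

signSum-∷ : {L : ℕ} (g : ℕ → ℚ) (x : ℤ) (a : ℕ) (r : Vec ℕ L) {b₊ b₋ : Bool} →
  does (signed false a ℤ.<? x) ≡ b₊ → does (signed true a ℤ.<? x) ≡ b₋ →
  signSum g x (a ∷ r) ≡ signSum (g ∘ suc-if b₊) (signed false a) r + signSum (g ∘ suc-if b₋) (signed true a) r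
signSum-∷ {L} g x a r b₊≡ b₋≡ =
  trans (sumOver-allSubsets-suc L (λ s → g ∣ desVec (x ∷ signWord (a ∷ r) s) ∣))
        (cong₂ _+_ (sumOver-cong (allSubsets L) (λ s → cong g (first false s b₊≡)))
                   (sumOver-cong (allSubsets L) (λ s → cong g (first true s b₋≡))))
  where
  first : ∀ e s {b} → does (signed e a ℤ.<? x) ≡ b →
    ∣ desVec (x ∷ signed e a ∷ signWord r s) ∣ ≡ suc-if b ∣ desVec (signed e a ∷ signWord r s) ∣
  first e s refl = trans (cong ∣_∣ (desVec-∷ x (signed e a) (signWord r s)))
                         (∣∷∣ (does (signed e a ℤ.<? x)) (desVec (signed e a ∷ signWord r s)))

<?-true : ∀ {a b} → a < b → ⌊ a <? b ⌋ ≡ true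
<?-true {a} {b} a<b = trans (isYes≗does (a <? b)) (dec-true (a <? b) a<b)

<?-false : ∀ {a b} → ¬ a < b → ⌊ a <? b ⌋ ≡ false
<?-false {a} {b} a≮b = trans (isYes≗does (a <? b)) (dec-false (a <? b) a≮b)

peakCount : {L : ℕ} → ℕ → ℕ → Vec ℕ L → ℕ
peakCount a₀ a₁ r = ∣ peaks3 (a₀ ∷ a₁ ∷ r) ∣

peakCount-∷ : ∀ {L} a₀ a₁ a₂ (r : Vec ℕ L) {b} → (⌊ a₀ <? a₁ ⌋ ∧ ⌊ a₂ <? a₁ ⌋) ≡ b →
  peakCount a₀ a₁ (a₂ ∷ r) ≡ suc-if b (peakCount a₁ a₂ r)
peakCount-∷ a₀ a₁ a₂ r refl = ∣∷∣ (⌊ a₀ <? a₁ ⌋ ∧ ⌊ a₂ <? a₁ ⌋) (peaks3 (a₁ ∷ a₂ ∷ r))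

peakCount-ascent : ∀ {L a₀ a₁ a₂} (r : Vec ℕ L) → a₀ < a₁ → a₁ < a₂ → peakCount a₀ a₁ (a₂ ∷ r) ≡ peakCount a₁ a₂ r
peakCount-ascent r a₀<a₁ a₁<a₂ = peakCount-∷ _ _ _ r (cong₂ _∧_ (<?-true a₀<a₁) (<?-false (ℕₚ.<-asym a₁<a₂)))

peakCount-peak : ∀ {L a₀ a₁ a₂} (r : Vec ℕ L) → a₀ < a₁ → a₂ < a₁ → peakCount a₀ a₁ (a₂ ∷ r) ≡ suc (peakCount a₁ a₂ r)
peakCount-peak r a₀<a₁ a₂<a₁ = peakCount-∷ _ _ _ r (cong₂ _∧_ (<?-true a₀<a₁) (<?-true a₂<a₁))

peakCount-descent : ∀ {L a₀ a₁ a₂} (r : Vec ℕ L) → a₁ < a₀ → peakCount a₀ a₁ (a₂ ∷ r) ≡ peakCount a₁ a₂ r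
peakCount-descent {a₁ = a₁} {a₂} r a₁<a₀ = peakCount-∷ _ _ _ r (cong (_∧ ⌊ a₂ <? a₁ ⌋) (<?-false (ℕₚ.<-asym a₁<a₀)))

AdjacentDistinct : {L : ℕ} → ℕ → Vec ℕ L → Set
AdjacentDistinct x []      = ⊤
AdjacentDistinct x (y ∷ r) = x ≢ y × AdjacentDistinct y r

-- Sums over the signs of a₁ r after a first letter a₀ of sign e: after an ascent a₀ < a₁ the
-- sign of a₀ is irrelevant, after a descent it decides whether a₀ a₁ is a descent.
AscentSum : ℕ → (L : ℕ) → ℕ → ℕ → Vec ℕ L → Set
AscentSum p L a₀ a₁ r = Σ ℕ λ q → (p ℕ.+ p ℕ.+ q ≡ suc L) ×
  (∀ e g → signSum g (signed e a₀) (a₁ ∷ r) ≡ 2ℚ ^ (p ℕ.+ p) * binomialSum q (λ d → g (p ℕ.+ d)))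

DescentSum : ℕ → (L : ℕ) → ℕ → ℕ → Vec ℕ L → Set
DescentSum p L a₀ a₁ r = Σ ℕ λ q → (p ℕ.+ p ℕ.+ q ≡ L) ×
  (∀ g → signSum g (signed false a₀) (a₁ ∷ r) ≡ 2ℚ ^ suc (p ℕ.+ p) * binomialSum q (λ d → g (suc (p ℕ.+ d)))) ×
  (∀ g → signSum g (signed true a₀) (a₁ ∷ r) ≡ 2ℚ ^ suc (p ℕ.+ p) * binomialSum q (λ d → g (p ℕ.+ d)))

twice : ∀ w x → w * x + w * x ≡ 2ℚ * w * x
twice = solve 2 (λ w x → w :* x :+ w :* x := con 2ℚ :* w :* x) refl

factor-swapped : ∀ w x y → w * x + w * y ≡ w * (y + x)
factor-swapped = solve 3 (λ w x y → w :* x :+ w :* y := w :* (y :+ x)) refl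

2^[2+2p] : (p : ℕ) → 2ℚ ^ (suc p ℕ.+ suc p) ≡ 2ℚ * 2ℚ ^ suc (p ℕ.+ p)
2^[2+2p] p = cong (λ n → 2ℚ ^ suc n) (ℕₚ.+-suc p p)

ascent-end : ∀ {a₀ a₁} → a₀ < a₁ → AscentSum 0 0 a₀ a₁ []
ascent-end {a₀} {a₁} a₀<a₁ = 1 , refl , λ e g → begin
  signSum g (signed e a₀) (a₁ ∷ [])
    ≡⟨ signSum-∷ g (signed e a₀) a₁ [] (descent-at-ascent a₀<a₁ e false) (descent-at-ascent a₀<a₁ e true) ⟩
  g 0 + 0ℚ + (g 1 + 0ℚ)
    ≡⟨ solve 2 (λ x y → x :+ con 0ℚ :+ (y :+ con 0ℚ) := con 1ℚ :* (x :+ y)) refl (g 0) (g 1) ⟩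
  1ℚ * (g 0 + g 1) ∎

descent-end : ∀ {a₀ a₁} → a₁ < a₀ → DescentSum 0 0 a₀ a₁ []
descent-end {a₀} {a₁} a₁<a₀ = 0 , refl ,
  (λ g → trans (signSum-∷ g (signed false a₀) a₁ [] (descent-at-descent a₁<a₀ false false) (descent-at-descent a₁<a₀ false true))
               (both (g 1))) ,
  (λ g → trans (signSum-∷ g (signed true a₀) a₁ [] (descent-at-descent a₁<a₀ true false) (descent-at-descent a₁<a₀ true true))
               (both (g 0)))
  where
  both : ∀ x → x + 0ℚ + (x + 0ℚ) ≡ 2ℚ ^ 1 * x
  both = solve 1 (λ x → x :+ con 0ℚ :+ (x :+ con 0ℚ) := con 2ℚ :* con 1ℚ :* x) refl

ascent-ascent : ∀ {p L a₀ a₁ a₂} {r : Vec ℕ L} → a₀ < a₁ → AscentSum p L a₁ a₂ r → AscentSum p (suc L) a₀ a₁ (a₂ ∷ r)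
ascent-ascent {p} {L} {a₀} {a₁} {a₂} {r} a₀<a₁ (q , 2p+q≡ , sum≡) =
  suc q , trans (ℕₚ.+-suc (p ℕ.+ p) q) (cong suc 2p+q≡) , λ e g → begin
  signSum g (signed e a₀) (a₁ ∷ a₂ ∷ r)
    ≡⟨ signSum-∷ g (signed e a₀) a₁ (a₂ ∷ r) (descent-at-ascent a₀<a₁ e false) (descent-at-ascent a₀<a₁ e true) ⟩
  signSum g (signed false a₁) (a₂ ∷ r) + signSum (g ∘ suc) (signed true a₁) (a₂ ∷ r)
    ≡⟨ cong₂ _+_ (sum≡ false g) (sum≡ true (g ∘ suc)) ⟩
  2ℚ ^ (p ℕ.+ p) * binomialSum q (λ d → g (p ℕ.+ d)) + 2ℚ ^ (p ℕ.+ p) * binomialSum q (λ d → g (suc (p ℕ.+ d)))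
    ≡⟨ ℚ.*-distribˡ-+ (2ℚ ^ (p ℕ.+ p)) _ _ ⟨
  2ℚ ^ (p ℕ.+ p) * (binomialSum q (λ d → g (p ℕ.+ d)) + binomialSum q (λ d → g (suc (p ℕ.+ d))))
    ≡⟨ cong (2ℚ ^ (p ℕ.+ p) *_) (binomialSum-from q p g) ⟨
  2ℚ ^ (p ℕ.+ p) * binomialSum (suc q) (λ d → g (p ℕ.+ d)) ∎

ascent-peak : ∀ {p L a₀ a₁ a₂} {r : Vec ℕ L} → a₀ < a₁ → DescentSum p L a₁ a₂ r → AscentSum (suc p) (suc L) a₀ a₁ (a₂ ∷ r)
ascent-peak {p} {L} {a₀} {a₁} {a₂} {r} a₀<a₁ (q , 2p+q≡ , sum₊≡ , sum₋≡) =
  q , trans (cong (λ n → suc n ℕ.+ q) (ℕₚ.+-suc p p)) (cong (λ n → suc (suc n)) 2p+q≡) , λ e g → begin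
  signSum g (signed e a₀) (a₁ ∷ a₂ ∷ r)
    ≡⟨ signSum-∷ g (signed e a₀) a₁ (a₂ ∷ r) (descent-at-ascent a₀<a₁ e false) (descent-at-ascent a₀<a₁ e true) ⟩
  signSum g (signed false a₁) (a₂ ∷ r) + signSum (g ∘ suc) (signed true a₁) (a₂ ∷ r)
    ≡⟨ cong₂ _+_ (sum₊≡ g) (sum₋≡ (g ∘ suc)) ⟩
  2ℚ ^ suc (p ℕ.+ p) * binomialSum q (λ d → g (suc (p ℕ.+ d))) + 2ℚ ^ suc (p ℕ.+ p) * binomialSum q (λ d → g (suc (p ℕ.+ d)))
    ≡⟨ twice (2ℚ ^ suc (p ℕ.+ p)) _ ⟩
  2ℚ * 2ℚ ^ suc (p ℕ.+ p) * binomialSum q (λ d → g (suc p ℕ.+ d))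
    ≡⟨ cong (_* binomialSum q (λ d → g (suc p ℕ.+ d))) (2^[2+2p] p) ⟨
  2ℚ ^ (suc p ℕ.+ suc p) * binomialSum q (λ d → g (suc p ℕ.+ d)) ∎

descent-valley : ∀ {p L a₀ a₁ a₂} {r : Vec ℕ L} → a₁ < a₀ → AscentSum p L a₁ a₂ r → DescentSum p (suc L) a₀ a₁ (a₂ ∷ r)
descent-valley {p} {L} {a₀} {a₁} {a₂} {r} a₁<a₀ (q , 2p+q≡ , sum≡) = q , 2p+q≡ ,
  (λ g → begin
    signSum g (signed false a₀) (a₁ ∷ a₂ ∷ r)
      ≡⟨ signSum-∷ g (signed false a₀) a₁ (a₂ ∷ r) (descent-at-descent a₁<a₀ false false) (descent-at-descent a₁<a₀ false true) ⟩
    signSum (g ∘ suc) (signed false a₁) (a₂ ∷ r) + signSum (g ∘ suc) (signed true a₁) (a₂ ∷ r)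
      ≡⟨ cong₂ _+_ (sum≡ false (g ∘ suc)) (sum≡ true (g ∘ suc)) ⟩
    2ℚ ^ (p ℕ.+ p) * binomialSum q (λ d → g (suc (p ℕ.+ d))) + 2ℚ ^ (p ℕ.+ p) * binomialSum q (λ d → g (suc (p ℕ.+ d)))
      ≡⟨ twice (2ℚ ^ (p ℕ.+ p)) _ ⟩
    2ℚ ^ suc (p ℕ.+ p) * binomialSum q (λ d → g (suc (p ℕ.+ d))) ∎) ,
  (λ g → begin
    signSum g (signed true a₀) (a₁ ∷ a₂ ∷ r)
      ≡⟨ signSum-∷ g (signed true a₀) a₁ (a₂ ∷ r) (descent-at-descent a₁<a₀ true false) (descent-at-descent a₁<a₀ true true) ⟩
    signSum g (signed false a₁) (a₂ ∷ r) + signSum g (signed true a₁) (a₂ ∷ r)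
      ≡⟨ cong₂ _+_ (sum≡ false g) (sum≡ true g) ⟩
    2ℚ ^ (p ℕ.+ p) * binomialSum q (λ d → g (p ℕ.+ d)) + 2ℚ ^ (p ℕ.+ p) * binomialSum q (λ d → g (p ℕ.+ d))
      ≡⟨ twice (2ℚ ^ (p ℕ.+ p)) _ ⟩
    2ℚ ^ suc (p ℕ.+ p) * binomialSum q (λ d → g (p ℕ.+ d)) ∎)

descent-descent : ∀ {p L a₀ a₁ a₂} {r : Vec ℕ L} → a₁ < a₀ → DescentSum p L a₁ a₂ r → DescentSum p (suc L) a₀ a₁ (a₂ ∷ r)
descent-descent {p} {L} {a₀} {a₁} {a₂} {r} a₁<a₀ (q , 2p+q≡ , sum₊≡ , sum₋≡) =
  suc q , trans (ℕₚ.+-suc (p ℕ.+ p) q) (cong suc 2p+q≡) ,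
  (λ g → begin
    signSum g (signed false a₀) (a₁ ∷ a₂ ∷ r)
      ≡⟨ signSum-∷ g (signed false a₀) a₁ (a₂ ∷ r) (descent-at-descent a₁<a₀ false false) (descent-at-descent a₁<a₀ false true) ⟩
    signSum (g ∘ suc) (signed false a₁) (a₂ ∷ r) + signSum (g ∘ suc) (signed true a₁) (a₂ ∷ r)
      ≡⟨ cong₂ _+_ (sum₊≡ (g ∘ suc)) (sum₋≡ (g ∘ suc)) ⟩
    2ℚ ^ suc (p ℕ.+ p) * binomialSum q (λ d → g (suc (suc (p ℕ.+ d)))) + 2ℚ ^ suc (p ℕ.+ p) * binomialSum q (λ d → g (suc (p ℕ.+ d)))
      ≡⟨ factor-swapped (2ℚ ^ suc (p ℕ.+ p)) _ _ ⟩
    2ℚ ^ suc (p ℕ.+ p) * (binomialSum q (λ d → g (suc (p ℕ.+ d))) + binomialSum q (λ d → g (suc (suc (p ℕ.+ d)))))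
      ≡⟨ cong (2ℚ ^ suc (p ℕ.+ p) *_) (binomialSum-from q p (g ∘ suc)) ⟨
    2ℚ ^ suc (p ℕ.+ p) * binomialSum (suc q) (λ d → g (suc (p ℕ.+ d))) ∎) ,
  (λ g → begin
    signSum g (signed true a₀) (a₁ ∷ a₂ ∷ r)
      ≡⟨ signSum-∷ g (signed true a₀) a₁ (a₂ ∷ r) (descent-at-descent a₁<a₀ true false) (descent-at-descent a₁<a₀ true true) ⟩
    signSum g (signed false a₁) (a₂ ∷ r) + signSum g (signed true a₁) (a₂ ∷ r)
      ≡⟨ cong₂ _+_ (sum₊≡ g) (sum₋≡ g) ⟩
    2ℚ ^ suc (p ℕ.+ p) * binomialSum q (λ d → g (suc (p ℕ.+ d))) + 2ℚ ^ suc (p ℕ.+ p) * binomialSum q (λ d → g (p ℕ.+ d))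
      ≡⟨ factor-swapped (2ℚ ^ suc (p ℕ.+ p)) _ _ ⟩
    2ℚ ^ suc (p ℕ.+ p) * (binomialSum q (λ d → g (p ℕ.+ d)) + binomialSum q (λ d → g (suc (p ℕ.+ d))))
      ≡⟨ cong (2ℚ ^ suc (p ℕ.+ p) *_) (binomialSum-from q p g) ⟨
    2ℚ ^ suc (p ℕ.+ p) * binomialSum (suc q) (λ d → g (p ℕ.+ d)) ∎)

mutual
  ascentSum : ∀ {L} a₀ a₁ (r : Vec ℕ L) → AdjacentDistinct a₁ r → a₀ < a₁ → AscentSum (peakCount a₀ a₁ r) L a₀ a₁ r
  ascentSum a₀ a₁ []       _                    a₀<a₁ = ascent-end a₀<a₁
  ascentSum a₀ a₁ (a₂ ∷ r) (a₁≢a₂ , distinct) a₀<a₁ with ℕₚ.<-cmp a₁ a₂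
  ... | tri< a₁<a₂ _ _ = subst (λ p → AscentSum p _ a₀ a₁ (a₂ ∷ r)) (sym (peakCount-ascent r a₀<a₁ a₁<a₂))
                               (ascent-ascent {peakCount a₁ a₂ r} a₀<a₁ (ascentSum a₁ a₂ r distinct a₁<a₂))
  ... | tri≈ _ a₁≡a₂ _ = contradiction a₁≡a₂ a₁≢a₂
  ... | tri> _ _ a₂<a₁ = subst (λ p → AscentSum p _ a₀ a₁ (a₂ ∷ r)) (sym (peakCount-peak r a₀<a₁ a₂<a₁))
                               (ascent-peak {peakCount a₁ a₂ r} a₀<a₁ (descentSum a₁ a₂ r distinct a₂<a₁))

  descentSum : ∀ {L} a₀ a₁ (r : Vec ℕ L) → AdjacentDistinct a₁ r → a₁ < a₀ → DescentSum (peakCount a₀ a₁ r) L a₀ a₁ r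
  descentSum a₀ a₁ []       _                    a₁<a₀ = descent-end a₁<a₀
  descentSum a₀ a₁ (a₂ ∷ r) (a₁≢a₂ , distinct) a₁<a₀ with ℕₚ.<-cmp a₁ a₂
  ... | tri< a₁<a₂ _ _ = subst (λ p → DescentSum p _ a₀ a₁ (a₂ ∷ r)) (sym (peakCount-descent r a₁<a₀))
                               (descent-valley {peakCount a₁ a₂ r} a₁<a₀ (ascentSum a₁ a₂ r distinct a₁<a₂))
  ... | tri≈ _ a₁≡a₂ _ = contradiction a₁≡a₂ a₁≢a₂
  ... | tri> _ _ a₂<a₁ = subst (λ p → DescentSum p _ a₀ a₁ (a₂ ∷ r)) (sym (peakCount-descent r a₁<a₀))
                               (descent-descent {peakCount a₁ a₂ r} a₁<a₀ (descentSum a₁ a₂ r distinct a₂<a₁))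

adjacentDistinct-tabulate : {m : ℕ} (f : Fin (suc m) → ℕ) → (∀ {i j} → f i ≡ f j → i ≡ j) →
  AdjacentDistinct (f zero) (tabulate (f ∘ suc))
adjacentDistinct-tabulate {zero}  f injective = tt
adjacentDistinct-tabulate {suc m} f injective =
  (λ f0≡f1 → contradiction (injective f0≡f1) λ ()) , adjacentDistinct-tabulate (f ∘ suc) (Fin.suc-injective ∘ injective)

entryA-injective : {m : ℕ} (σ : Permutation′ m) {i j : Fin m} → entryA σ i ≡ entryA σ j → i ≡ j
entryA-injective σ {i} {j} σi≡σj =
  trans (sym (inverseˡ σ)) (trans (cong (σ ⟨$⟩ˡ_) (Fin.toℕ-injective (ℕₚ.suc-injective σi≡σj))) (inverseˡ σ))

peakSignSum : {m : ℕ} (σ : Permutation′ m) → Σ ℕ λ q → (pk σ ℕ.+ pk σ ℕ.+ q ≡ m) ×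
  (∀ g → signSum g 0ℤ (tabulate (entryA σ)) ≡ 2ℚ ^ (pk σ ℕ.+ pk σ) * binomialSum q (λ d → g (pk σ ℕ.+ d)))
peakSignSum {zero}  σ = 0 , refl , λ g → solve 1 (λ x → x :+ con 0ℚ := con 1ℚ :* x) refl (g 0)
peakSignSum {suc L} σ =
  let q , 2p+q≡ , sum≡ = ascentSum 0 (entryA σ zero) (tabulate (entryA σ ∘ suc))
                                   (adjacentDistinct-tabulate (entryA σ) (entryA-injective σ)) (s≤s z≤n)
  in q , 2p+q≡ , sum≡ false

pk-bound : {m : ℕ} (σ : Permutation′ m) → pk σ ℕ.+ pk σ ≤ m
pk-bound {m} σ = let q , 2p+q≡m , _ = peakSignSum σ in subst (pk σ ℕ.+ pk σ ≤_) 2p+q≡m (ℕₚ.m≤m+n _ q)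

φ-onPeaks : ℕ → (ℕ → ℚ) → ℕ → ℚ
φ-onPeaks m g p = 2ℚ ^ (p ℕ.+ p) * binomialSum (m ℕ.∸ (p ℕ.+ p)) (λ d → g (p ℕ.+ d))

φ-desFunction : {m : ℕ} {v : QB m} (g : ℕ → ℚ) → (∀ w → v w ≡ g (des w)) → ∀ σ → φ v σ ≡ φ-onPeaks m g (pk σ)
φ-desFunction {m} {v} g v≗ σ with peakSignSum σ
... | q , 2p+q≡m , sum≡ = begin
  sumOver (allSubsets m) (λ s → v (σ , s))
    ≡⟨ sumOver-cong (allSubsets m) (λ s → trans (v≗ (σ , s)) (cong (g ∘ ∣_∣) (Des-signWord σ s))) ⟩
  signSum g 0ℤ (tabulate (entryA σ))
    ≡⟨ sum≡ g ⟩
  2ℚ ^ (pk σ ℕ.+ pk σ) * binomialSum q (λ d → g (pk σ ℕ.+ d))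
    ≡⟨ cong (λ n → 2ℚ ^ (pk σ ℕ.+ pk σ) * binomialSum n (λ d → g (pk σ ℕ.+ d))) q≡ ⟩
  φ-onPeaks m g (pk σ) ∎
  where
  q≡ : q ≡ m ℕ.∸ (pk σ ℕ.+ pk σ)
  q≡ = trans (sym (ℕₚ.m+n∸m≡n (pk σ ℕ.+ pk σ) q)) (cong (ℕ._∸ (pk σ ℕ.+ pk σ)) 2p+q≡m)

2^-+ : (a b : ℕ) → 2ℚ ^ (a ℕ.+ b) ≡ 2ℚ ^ a * 2ℚ ^ b
2^-+ zero    b = sym (ℚ.*-identityˡ _)
2^-+ (suc a) b = trans (cong (2ℚ *_) (2^-+ a b)) (sym (ℚ.*-assoc 2ℚ (2ℚ ^ a) (2ℚ ^ b)))

2^-½^ : (n : ℕ) (c : ℚ) → 2ℚ ^ n * (½ ^ n * c) ≡ c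
2^-½^ zero    c = trans (ℚ.*-identityˡ _) (ℚ.*-identityˡ c)
2^-½^ (suc n) c = begin
  2ℚ * 2ℚ ^ n * (½ * ½ ^ n * c)
    ≡⟨ solve 5 (λ t h x y c → t :* x :* (h :* y :* c) := (t :* h) :* (x :* (y :* c))) refl 2ℚ ½ (2ℚ ^ n) (½ ^ n) c ⟩
  2ℚ * ½ * (2ℚ ^ n * (½ ^ n * c))  ≡⟨ cong (2ℚ * ½ *_) (2^-½^ n c) ⟩
  2ℚ * ½ * c                       ≡⟨ ℚ.*-identityˡ c ⟩
  c                                ∎

binomialSum-+ : (q : ℕ) (g h : ℕ → ℚ) → binomialSum q (λ d → g d + h d) ≡ binomialSum q g + binomialSum q h
binomialSum-+ zero    g h = refl
binomialSum-+ (suc q) g h = begin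
  binomialSum q (λ d → g d + h d) + binomialSum q (λ d → g (suc d) + h (suc d))
    ≡⟨ cong₂ _+_ (binomialSum-+ q g h) (binomialSum-+ q (g ∘ suc) (h ∘ suc)) ⟩
  binomialSum q g + binomialSum q h + (binomialSum q (g ∘ suc) + binomialSum q (h ∘ suc))
    ≡⟨ solve 4 (λ a b c d → a :+ b :+ (c :+ d) := a :+ c :+ (b :+ d)) refl
               (binomialSum q g) (binomialSum q h) (binomialSum q (g ∘ suc)) (binomialSum q (h ∘ suc)) ⟩
  binomialSum q g + binomialSum q (g ∘ suc) + (binomialSum q h + binomialSum q (h ∘ suc)) ∎

binomialSum-const : (q : ℕ) (c : ℚ) → binomialSum q (λ _ → c) ≡ 2ℚ ^ q * c
binomialSum-const zero    c = sym (ℚ.*-identityˡ c)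
binomialSum-const (suc q) c = trans (cong₂ _+_ (binomialSum-const q c) (binomialSum-const q c)) (twice (2ℚ ^ q) c)

binomialSum-Δ² : (q : ℕ) (G : ℕ → ℚ) →
  binomialSum q (Δ² G) ≡ binomialSum (suc (suc q)) G - 2ℚ * 2ℚ * binomialSum q (G ∘ suc)
binomialSum-Δ² zero    G =
  solve 3 (λ x y z → x :- y :- y :+ z := x :+ y :+ (y :+ z) :- con 2ℚ :* con 2ℚ :* y) refl (G 0) (G 1) (G 2)
binomialSum-Δ² (suc q) G = begin
  binomialSum q (Δ² G) + binomialSum q (Δ² (G ∘ suc))
    ≡⟨ cong₂ _+_ (binomialSum-Δ² q G) (binomialSum-Δ² q (G ∘ suc)) ⟩
  B₀ + B₁ + (B₁ + B₂) - 2ℚ * 2ℚ * B₁ + (B₁ + B₂ + (B₂ + B₃) - 2ℚ * 2ℚ * B₂)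
    ≡⟨ solve 4 (λ x y z t → x :+ y :+ (y :+ z) :- con 2ℚ :* con 2ℚ :* y :+ (y :+ z :+ (z :+ t) :- con 2ℚ :* con 2ℚ :* z)
                       := x :+ y :+ (y :+ z) :+ (y :+ z :+ (z :+ t)) :- con 2ℚ :* con 2ℚ :* (y :+ z)) refl B₀ B₁ B₂ B₃ ⟩
  B₀ + B₁ + (B₁ + B₂) + (B₁ + B₂ + (B₂ + B₃)) - 2ℚ * 2ℚ * (B₁ + B₂) ∎
  where
  B₀ B₁ B₂ B₃ : ℚ
  B₀ = binomialSum q G
  B₁ = binomialSum q (G ∘ ℕ.suc)
  B₂ = binomialSum q (G ∘ ℕ.suc ∘ ℕ.suc)
  B₃ = binomialSum q (G ∘ ℕ.suc ∘ ℕ.suc ∘ ℕ.suc)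

φ-onPeaks-cong : (m p : ℕ) {g h : ℕ → ℚ} → (∀ d → g d ≡ h d) → φ-onPeaks m g p ≡ φ-onPeaks m h p
φ-onPeaks-cong m p g≗h = cong (2ℚ ^ (p ℕ.+ p) *_) (binomialSum-cong (m ℕ.∸ (p ℕ.+ p)) (g≗h ∘ (p ℕ.+_)))

φ-onPeaks-+ : (m p : ℕ) (g h : ℕ → ℚ) → φ-onPeaks m (λ d → g d + h d) p ≡ φ-onPeaks m g p + φ-onPeaks m h p
φ-onPeaks-+ m p g h = trans (cong (2ℚ ^ (p ℕ.+ p) *_) (binomialSum-+ (m ℕ.∸ (p ℕ.+ p)) (g ∘ (p ℕ.+_)) (h ∘ (p ℕ.+_))))
                            (ℚ.*-distribˡ-+ (2ℚ ^ (p ℕ.+ p)) _ _)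

φ-onPeaks-const : (m p : ℕ) (c : ℚ) → p ℕ.+ p ≤ m → φ-onPeaks m (λ _ → c) p ≡ 2ℚ ^ m * c
φ-onPeaks-const m p c 2p≤m = begin
  2ℚ ^ (p ℕ.+ p) * binomialSum (m ℕ.∸ (p ℕ.+ p)) (λ _ → c)
    ≡⟨ cong (2ℚ ^ (p ℕ.+ p) *_) (binomialSum-const (m ℕ.∸ (p ℕ.+ p)) c) ⟩
  2ℚ ^ (p ℕ.+ p) * (2ℚ ^ (m ℕ.∸ (p ℕ.+ p)) * c)
    ≡⟨ ℚ.*-assoc (2ℚ ^ (p ℕ.+ p)) (2ℚ ^ (m ℕ.∸ (p ℕ.+ p))) c ⟨
  2ℚ ^ (p ℕ.+ p) * 2ℚ ^ (m ℕ.∸ (p ℕ.+ p)) * c                 ≡⟨ cong (_* c) (2^-+ (p ℕ.+ p) _) ⟨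
  2ℚ ^ (p ℕ.+ p ℕ.+ (m ℕ.∸ (p ℕ.+ p))) * c                    ≡⟨ cong (λ n → 2ℚ ^ n * c) (ℕₚ.m+[n∸m]≡n 2p≤m) ⟩
  2ℚ ^ m * c                                                  ∎

φ-onPeaks-step : (k p : ℕ) (g : ℕ → ℚ) → p ℕ.+ p ≤ k →
  φ-onPeaks (suc (suc k)) g p - φ-onPeaks (suc (suc k)) g (suc p) ≡ φ-onPeaks k (Δ² g) p
φ-onPeaks-step k p g 2p≤k = begin
  φ-onPeaks (2 ℕ.+ k) g p - φ-onPeaks (2 ℕ.+ k) g (suc p)
    ≡⟨ cong₂ (λ n e → 2ℚ ^ (p ℕ.+ p) * binomialSum n G - 2ℚ ^ e * binomialSum (2 ℕ.+ k ℕ.∸ e) (λ d → g (suc p ℕ.+ d)))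
             (ℕₚ.+-∸-assoc 2 2p≤k) (cong suc (ℕₚ.+-suc p p)) ⟩
  W * binomialSum (2 ℕ.+ q) G - 2ℚ * (2ℚ * W) * binomialSum q (λ d → g (suc (p ℕ.+ d)))
    ≡⟨ cong (λ B → W * binomialSum (2 ℕ.+ q) G - 2ℚ * (2ℚ * W) * B) (binomialSum-cong q (λ d → cong g (sym (ℕₚ.+-suc p d)))) ⟩
  W * binomialSum (2 ℕ.+ q) G - 2ℚ * (2ℚ * W) * binomialSum q (G ∘ suc)
    ≡⟨ solve 3 (λ w x y → w :* x :- con 2ℚ :* (con 2ℚ :* w) :* y := w :* (x :- con 2ℚ :* con 2ℚ :* y))
             refl W (binomialSum (2 ℕ.+ q) G) (binomialSum q (G ∘ suc)) ⟩
  W * (binomialSum (2 ℕ.+ q) G - 2ℚ * 2ℚ * binomialSum q (G ∘ suc))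
    ≡⟨ cong (W *_) (binomialSum-Δ² q G) ⟨
  W * binomialSum q (Δ² G)
    ≡⟨ cong (W *_) (binomialSum-cong q Δ²G≗) ⟩
  φ-onPeaks k (Δ² g) p ∎
  where
  q : ℕ
  q = k ℕ.∸ (p ℕ.+ p)
  W : ℚ
  W = 2ℚ ^ (p ℕ.+ p)
  G : ℕ → ℚ
  G d = g (p ℕ.+ d)
  Δ²G≗ : ∀ d → Δ² G d ≡ Δ² g (p ℕ.+ d)
  Δ²G≗ d = cong₂ (λ x y → G d - x - x + y) (cong g (ℕₚ.+-suc p d))
                 (cong g (trans (ℕₚ.+-suc p (suc d)) (cong suc (ℕₚ.+-suc p d))))

φ-onPeaks-Δ²≡0 : (g : ℕ → ℚ) → (∀ d → Δ² g d ≡ 0ℚ) → ∀ m p → p ℕ.+ p ≤ m → φ-onPeaks m g p ≡ φ-onPeaks m g 0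
φ-onPeaks-Δ²≡0 g Δ²g≡0 m             zero    _    = refl
φ-onPeaks-Δ²≡0 g Δ²g≡0 zero          (suc p) ()
φ-onPeaks-Δ²≡0 g Δ²g≡0 (suc zero)    (suc p) (s≤s 2p+1≤0) = contradiction (subst (_≤ 0) (ℕₚ.+-suc p p) 2p+1≤0) λ ()
φ-onPeaks-Δ²≡0 g Δ²g≡0 (suc (suc k)) (suc p) 2p+2≤k+2 = begin
  φ-onPeaks (2 ℕ.+ k) g (suc p)   ≡⟨ equal-neighbours ⟨
  φ-onPeaks (2 ℕ.+ k) g p         ≡⟨ φ-onPeaks-Δ²≡0 g Δ²g≡0 (2 ℕ.+ k) p (ℕₚ.≤-trans 2p≤k (ℕₚ.m≤n+m k 2)) ⟩
  φ-onPeaks (2 ℕ.+ k) g 0         ∎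
  where
  2p≤k : p ℕ.+ p ≤ k
  2p≤k = double-suc-≤ p k 2p+2≤k+2
  equal-neighbours : φ-onPeaks (2 ℕ.+ k) g p ≡ φ-onPeaks (2 ℕ.+ k) g (suc p)
  equal-neighbours = x∙y⁻¹≈ε⇒x≈y _ _ (begin
    φ-onPeaks (2 ℕ.+ k) g p - φ-onPeaks (2 ℕ.+ k) g (suc p) ≡⟨ φ-onPeaks-step k p g 2p≤k ⟩
    φ-onPeaks k (Δ² g) p                                   ≡⟨ φ-onPeaks-cong k p Δ²g≡0 ⟩
    φ-onPeaks k (λ _ → 0ℚ) p                               ≡⟨ φ-onPeaks-const k p 0ℚ 2p≤k ⟩
    2ℚ ^ k * 0ℚ                                            ≡⟨ ℚ.*-zeroʳ (2ℚ ^ k) ⟩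
    0ℚ                                                     ∎)

constant-gap : (k : ℕ) (F G : ℕ → ℚ) → (∀ p → p ℕ.+ p ≤ k → F p - F (suc p) ≡ G p - G (suc p)) →
  ∀ p → p ℕ.+ p ≤ suc (suc k) → G p - F p ≡ G 0 - F 0
constant-gap k F G same-differences zero    _          = refl
constant-gap k F G same-differences (suc p) 2p+2≤k+2 = begin
  G (suc p) - F (suc p)
    ≡⟨ solve 4 (λ f₀ f₁ g₀ g₁ → g₁ :- f₁ := (g₀ :- f₀) :- ((g₀ :- g₁) :- (f₀ :- f₁))) refl
               (F p) (F (suc p)) (G p) (G (suc p)) ⟩
  (G p - F p) - ((G p - G (suc p)) - (F p - F (suc p)))
    ≡⟨ cong₂ _-_ (constant-gap k F G same-differences p (ℕₚ.≤-trans 2p≤k (ℕₚ.m≤n+m k 2)))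
                 (trans (cong (λ x → (G p - G (suc p)) - x) (same-differences p 2p≤k)) (ℚ.+-inverseʳ (G p - G (suc p)))) ⟩
  (G 0 - F 0) - 0ℚ
    ≡⟨ solve 1 (λ x → x :- con 0ℚ := x) refl (G 0 - F 0) ⟩
  G 0 - F 0 ∎
  where
  2p≤k : p ℕ.+ p ≤ k
  2p≤k = double-suc-≤ p k 2p+2≤k+2

φ-onPeaks-surjective : (m : ℕ) (f : ℕ → ℚ) → Σ (ℕ → ℚ) λ g → ∀ p → p ℕ.+ p ≤ m → φ-onPeaks m g p ≡ f p
φ-onPeaks-surjective zero f = (λ _ → f 0) , matches
  where
  matches : ∀ p → p ℕ.+ p ≤ 0 → φ-onPeaks 0 (λ _ → f 0) p ≡ f p
  matches zero _ = ℚ.*-identityˡ (f 0)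
φ-onPeaks-surjective (suc zero) f = g , matches
  where
  g : ℕ → ℚ
  g zero    = f 0
  g (suc _) = 0ℚ
  matches : ∀ p → p ℕ.+ p ≤ 1 → φ-onPeaks 1 g p ≡ f p
  matches zero          _ = trans (ℚ.*-identityˡ _) (ℚ.+-identityʳ (f 0))
  matches (suc p) (s≤s 2p+1≤0) = contradiction (subst (_≤ 0) (ℕₚ.+-suc p p) 2p+1≤0) λ ()
φ-onPeaks-surjective (suc (suc k)) f with φ-onPeaks-surjective k (λ p → f p - f (suc p))
... | h , h-matches = g , matches
  where
  G₀ : ℕ → ℚ
  G₀ = secondAntidifference h
  c : ℚ
  c = f 0 - φ-onPeaks (2 ℕ.+ k) G₀ 0
  g : ℕ → ℚ
  g d = G₀ d + ½ ^ (2 ℕ.+ k) * c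
  same-differences : ∀ p → p ℕ.+ p ≤ k → φ-onPeaks (2 ℕ.+ k) G₀ p - φ-onPeaks (2 ℕ.+ k) G₀ (suc p) ≡ f p - f (suc p)
  same-differences p 2p≤k =
    trans (φ-onPeaks-step k p G₀ 2p≤k) (trans (φ-onPeaks-cong k p (Δ²-secondAntidifference h)) (h-matches p 2p≤k))
  matches : ∀ p → p ℕ.+ p ≤ 2 ℕ.+ k → φ-onPeaks (2 ℕ.+ k) g p ≡ f p
  matches p 2p≤k+2 = begin
    φ-onPeaks (2 ℕ.+ k) g p
      ≡⟨ φ-onPeaks-+ (2 ℕ.+ k) p G₀ (λ _ → ½ ^ (2 ℕ.+ k) * c) ⟩
    φ-onPeaks (2 ℕ.+ k) G₀ p + φ-onPeaks (2 ℕ.+ k) (λ _ → ½ ^ (2 ℕ.+ k) * c) p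
      ≡⟨ cong (φ-onPeaks (2 ℕ.+ k) G₀ p +_) (trans (φ-onPeaks-const (2 ℕ.+ k) p _ 2p≤k+2) (2^-½^ (2 ℕ.+ k) c)) ⟩
    φ-onPeaks (2 ℕ.+ k) G₀ p + c
      ≡⟨ cong (φ-onPeaks (2 ℕ.+ k) G₀ p +_) (constant-gap k (φ-onPeaks (2 ℕ.+ k) G₀) f same-differences p 2p≤k+2) ⟨
    φ-onPeaks (2 ℕ.+ k) G₀ p + (f p - φ-onPeaks (2 ℕ.+ k) G₀ p)
      ≡⟨ solve 2 (λ x y → x :+ (y :- x) := y) refl (φ-onPeaks (2 ℕ.+ k) G₀ p) (f p) ⟩
    f p ∎

double≤⇒≤half : ∀ p m → p ℕ.+ p ≤ m → p ≤ m / 2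
double≤⇒≤half p m 2p≤m = subst (_≤ m / 2) (m*n/n≡m p 2)
  (/-monoˡ-≤ 2 (subst (_≤ m) (sym (trans (ℕₚ.*-comm p 2) (cong (p ℕ.+_) (ℕₚ.+-identityʳ p)))) 2p≤m))

module PeakLevels (m : ℕ) =
  LevelSets (suc (m / 2)) pk (λ i → pA m (toℕ i)) (λ i σ → cong 𝟙 (isYes≗does (pk σ ℕ.≟ toℕ i)))

pk<1+m/2 : {m : ℕ} (σ : Permutation′ m) → pk σ < suc (m / 2)
pk<1+m/2 {m} σ = s≤s (double≤⇒≤half (pk σ) m (pk-bound σ))

InPeakSpan⇒factorsThrough : {m : ℕ} {v : QS m} → InPeakSpan m v → FactorsThrough pk v
InPeakSpan⇒factorsThrough {m} = PeakLevels.inSpan⇒factorsThrough m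

factorsThrough⇒InPeakSpan : {m : ℕ} {v : QS m} → FactorsThrough pk v → InPeakSpan m v
factorsThrough⇒InPeakSpan {m} = PeakLevels.factorsThrough⇒inSpan m pk<1+m/2

sumP≡1 : (m : ℕ) (σ : Permutation′ m) → sumP m σ ≡ 1ℚ
sumP≡1 m = PeakLevels.sumOver-levels m pk<1+m/2

InΣp⇒constant : {m : ℕ} {v : QS m} → InΣp m v → Σ ℚ λ c → ∀ σ → v σ ≡ c
InΣp⇒constant {m} (c , v≗) = c zero , λ σ →
  trans (v≗ σ) (trans (cong (λ s → c zero * s + 0ℚ) (sumP≡1 m σ))
                      (solve 1 (λ x → x :* con 1ℚ :+ con 0ℚ := x) refl (c zero)))

constant⇒InΣp : {m : ℕ} {v : QS m} (c : ℚ) → (∀ σ → v σ ≡ c) → InΣp m v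
constant⇒InΣp {m} c v≡c = (λ _ → c) , λ σ →
  trans (v≡c σ) (sym (trans (cong (λ s → c * s + 0ℚ) (sumP≡1 m σ)) (solve 1 (λ x → x :* con 1ℚ :+ con 0ℚ := x) refl c)))

InΣp⇒InPeakSpan : (m : ℕ) (v : QS m) → InΣp m v → InPeakSpan m v
InΣp⇒InPeakSpan m v Σp = let c , v≡c = InΣp⇒constant Σp in factorsThrough⇒InPeakSpan ((λ _ → c) , v≡c)

Pi-exists : (k : ℕ) (v : QS (suc (suc k))) → InPeakSpan (suc (suc k)) v → Σ (QS k) λ u → Pi k v u
Pi-exists k v ℘ = let f , v≗ = InPeakSpan⇒factorsThrough ℘ in (λ τ → f (pk τ) - f (suc (pk τ))) , Pi-pkFunction f v≗

Pi-functional : {k : ℕ} {v : QS (suc (suc k))} {u u′ : QS k} → Pi k v u → Pi k v u′ → u ≗ℚ u′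
Pi-functional π π′ τ = trans (Pi-apply π τ) (sym (Pi-apply π′ τ))

Pi-preserves-PeakSpan : (k : ℕ) (v : QS (suc (suc k))) (u : QS k) → InPeakSpan (suc (suc k)) v → Pi k v u → InPeakSpan k u
Pi-preserves-PeakSpan k v u ℘ π =
  let f , v≗ = InPeakSpan⇒factorsThrough ℘ in factorsThrough⇒InPeakSpan ((λ p → f p - f (suc p)) , Pi-pkFunction-apply f π v≗)

antidifference : (ℕ → ℚ) → ℕ → ℚ
antidifference h zero    = 0ℚ
antidifference h (suc p) = antidifference h p - h p

antidifference-difference : (h : ℕ → ℚ) (p : ℕ) → antidifference h p - antidifference h (suc p) ≡ h p
antidifference-difference h p = solve 2 (λ x y → x :- (x :- y) := y) refl (antidifference h p) (h p)

Pi-onto-PeakSpan : (k : ℕ) (u : QS k) → InPeakSpan k u → Σ (QS (suc (suc k))) λ v → InPeakSpan (suc (suc k)) v × Pi k v u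
Pi-onto-PeakSpan k u ℘ with InPeakSpan⇒factorsThrough ℘
... | h , u≗ = antidifference h ∘ pk , factorsThrough⇒InPeakSpan (antidifference h , λ _ → refl) ,
  Pi-resp (Pi-pkFunction (antidifference h) (λ _ → refl)) (λ τ → trans (u≗ τ) (sym (antidifference-difference h (pk τ))))

Pi-kernel⇒InΣp : (k : ℕ) (v : QS (suc (suc k))) → InPeakSpan (suc (suc k)) v → Pi k v zeroV → InΣp (suc (suc k)) v
Pi-kernel⇒InΣp k v ℘ π with InPeakSpan⇒factorsThrough ℘
... | f , v≗ = constant⇒InΣp (f 0) (λ σ → trans (v≗ σ) (f-constant (pk σ) (pk-bound σ)))
  where
  f-step : ∀ q → q ℕ.+ q ≤ k → f q ≡ f (suc q)
  f-step q 2q≤k = let τ , pkτ≡q = pk-realisable k q 2q≤k in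
    x∙y⁻¹≈ε⇒x≈y (f q) (f (suc q))
      (subst (λ p → f p - f (suc p) ≡ 0ℚ) pkτ≡q (sym (Pi-pkFunction-apply f π v≗ τ)))
  f-constant : ∀ q → q ℕ.+ q ≤ suc (suc k) → f q ≡ f 0
  f-constant zero    _          = refl
  f-constant (suc q) 2q+2≤k+2 =
    trans (sym (f-step q 2q≤k)) (f-constant q (ℕₚ.≤-trans 2q≤k (ℕₚ.m≤n+m k 2)))
    where
    2q≤k : q ℕ.+ q ≤ k
    2q≤k = double-suc-≤ q k 2q+2≤k+2

InΣp⇒Pi-kernel : (k : ℕ) (v : QS (suc (suc k))) → InΣp (suc (suc k)) v → Pi k v zeroV
InΣp⇒Pi-kernel k v Σp =
  let c , v≡c = InΣp⇒constant Σp in Pi-resp (Pi-pkFunction (λ _ → c) v≡c) (λ _ → sym (ℚ.+-inverseʳ c))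

φ-InX⇒InΣp : (k : ℕ) (v : QB (suc (suc k))) → InX k v → InΣp (suc (suc k)) (φ v)
φ-InX⇒InΣp k v (c , v≗) = constant⇒InΣp (φ-onPeaks (suc (suc k)) (xCombination k c) 0) λ σ →
  trans (φ-desFunction (xCombination k c) (λ w → trans (v≗ w) (InX-apply k c w)) σ)
        (φ-onPeaks-Δ²≡0 (xCombination k c) (Δ²-xCombination k c) (suc (suc k)) (pk σ) (pk-bound σ))

φ-onto-InΣp : (k : ℕ) (u : QS (suc (suc k))) → InΣp (suc (suc k)) u → Σ (QB (suc (suc k))) λ v → InX k v × φ v ≗ℚ u
φ-onto-InΣp k u Σp with InΣp⇒constant Σp
... | c , u≡c = v , (coefficients , λ _ → refl) , λ σ → begin
  φ v σ                                                  ≡⟨ φ-desFunction (xCombination k coefficients) (InX-apply k coefficients) σ ⟩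
  φ-onPeaks (suc (suc k)) (xCombination k coefficients) (pk σ)
    ≡⟨ φ-onPeaks-cong (suc (suc k)) (pk σ)
         (λ d → solve 2 (λ a x → a :* con 1ℚ :+ (con 0ℚ :* x :+ con 0ℚ) := a) refl α (suc (suc k) · 1ℚ - d · 1ℚ)) ⟩
  φ-onPeaks (suc (suc k)) (λ _ → α) (pk σ)               ≡⟨ φ-onPeaks-const (suc (suc k)) (pk σ) α (pk-bound σ) ⟩
  2ℚ ^ suc (suc k) * α                                   ≡⟨ 2^-½^ (suc (suc k)) c ⟩
  c                                                      ≡⟨ u≡c σ ⟨
  u σ                                                    ∎
  where
  α : ℚ
  α = ½ ^ suc (suc k) * c
  coefficients : Fin 2 → ℚ
  coefficients zero    = α
  coefficients (suc _) = 0ℚ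
  v : QB (suc (suc k))
  v = ⅀ (allFinL 2) (λ i a → coefficients i * xTop k i a)

φ-Sol⇒PeakSpan : (m : ℕ) (v : QB m) → InSol m v → InPeakSpan m (φ v)
φ-Sol⇒PeakSpan m v sol =
  let g , v≗ = InSol⇒factorsThrough sol in factorsThrough⇒InPeakSpan (φ-onPeaks m g , φ-desFunction g v≗)

φ-onto-PeakSpan : (m : ℕ) (u : QS m) → InPeakSpan m u → Σ (QB m) λ v → InSol m v × φ v ≗ℚ u
φ-onto-PeakSpan m u ℘ with InPeakSpan⇒factorsThrough ℘
... | f , u≗ with φ-onPeaks-surjective m f
...   | g , g-matches = g ∘ des , factorsThrough⇒InSol (g , λ _ → refl) , λ σ →
  trans (φ-desFunction g (λ _ → refl) σ) (trans (g-matches (pk σ) (pk-bound σ)) (sym (u≗ σ)))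

φ-commutes : (k : ℕ) (v : QB (suc (suc k))) (u : QB k) → InSol (suc (suc k)) v → Beta2 k v u → Pi k (φ v) (φ u)
φ-commutes k v u sol β with InSol⇒factorsThrough sol
... | g , v≗ = Pi-resp (Pi-pkFunction (φ-onPeaks (suc (suc k)) g) (φ-desFunction g v≗)) λ τ → begin
  φ u τ                                                             ≡⟨ φ-desFunction (Δ² g) (Beta2-desFunction-apply g β v≗) τ ⟩
  φ-onPeaks k (Δ² g) (pk τ)                                         ≡⟨ φ-onPeaks-step k (pk τ) g (pk-bound τ) ⟨
  φ-onPeaks (suc (suc k)) g (pk τ) - φ-onPeaks (suc (suc k)) g (suc (pk τ)) ∎

corollary6p12 :
    (k : ℕ) →
    -- top row: Span{x_n,x_{n-1}} ⊆ sol(B_n)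
      (∀ v → InX k v → InSol (suc (suc k)) v)
    -- β² is defined on sol(B_n) and single-valued there
    × (∀ v → InSol (suc (suc k)) v → Σ (QB k) λ u → Beta2 k v u)
    × (∀ v u u′ → InSol (suc (suc k)) v → Beta2 k v u → Beta2 k v u′ → u ≗ℚ u′)
    -- β² sends sol(B_n) into sol(B_{n-2}) ...
    × (∀ v u → InSol (suc (suc k)) v → Beta2 k v u → InSol k u)
    -- ... and onto sol(B_{n-2})
    × (∀ u → InSol k u → Σ (QB (suc (suc k))) λ v → InSol (suc (suc k)) v × Beta2 k v u)
    -- exactness at sol(B_n): ker(β² |sol(B_n)) = Span{x_n,x_{n-1}}
    × (∀ v → (InSol (suc (suc k)) v × Beta2 k v zeroV → InX k v) × (InX k v → InSol (suc (suc k)) v × Beta2 k v zeroV))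
    -- bottom row: Span{Σ p_j} ⊆ ℘_n
    × (∀ v → InΣp (suc (suc k)) v → InPeakSpan (suc (suc k)) v)
    -- π is defined on ℘_n and single-valued there
    × (∀ v → InPeakSpan (suc (suc k)) v → Σ (QS k) λ u → Pi k v u)
    × (∀ v u u′ → InPeakSpan (suc (suc k)) v → Pi k v u → Pi k v u′ → u ≗ℚ u′)
    -- π sends ℘_n into ℘_{n-2} and onto ℘_{n-2}
    × (∀ v u → InPeakSpan (suc (suc k)) v → Pi k v u → InPeakSpan k u)
    × (∀ u → InPeakSpan k u → Σ (QS (suc (suc k))) λ v → InPeakSpan (suc (suc k)) v × Pi k v u)
    -- exactness at ℘_n: ker(π |℘_n) = Span{Σ p_j}
    × (∀ v → (InPeakSpan (suc (suc k)) v × Pi k v zeroV → InΣp (suc (suc k)) v) × (InΣp (suc (suc k)) v → InPeakSpan (suc (suc k)) v × Pi k v zeroV))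
    -- vertical maps φ: well defined and surjective
    × (∀ v → InX k v → InΣp (suc (suc k)) (φ v))
    × (∀ u → InΣp (suc (suc k)) u → Σ (QB (suc (suc k))) λ v → InX k v × φ v ≗ℚ u)
    × (∀ v → InSol (suc (suc k)) v → InPeakSpan (suc (suc k)) (φ v))
    × (∀ u → InPeakSpan (suc (suc k)) u → Σ (QB (suc (suc k))) λ v → InSol (suc (suc k)) v × φ v ≗ℚ u)
    × (∀ v → InSol k v → InPeakSpan k (φ v))
    × (∀ u → InPeakSpan k u → Σ (QB k) λ v → InSol k v × φ v ≗ℚ u)
    -- commutativity of the right square: π ∘ φ = φ ∘ β² on sol(B_n)
    × (∀ v u → InSol (suc (suc k)) v → Beta2 k v u → Pi k (φ v) (φ u))
corollary6p12 k =
    InX⇒InSol k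
  , Beta2-exists k
  , (λ _ _ _ _ → Beta2-functional)
  , Beta2-preserves-Sol k
  , Beta2-onto-Sol k
  , (λ v → uncurry (Beta2-kernel⇒InX k v) , λ x → InX⇒InSol k v x , InX⇒Beta2-kernel k v x)
  , InΣp⇒InPeakSpan (suc (suc k))
  , Pi-exists k
  , (λ _ _ _ _ → Pi-functional)
  , Pi-preserves-PeakSpan k
  , Pi-onto-PeakSpan k
  , (λ v → uncurry (Pi-kernel⇒InΣp k v) , λ Σp → InΣp⇒InPeakSpan (suc (suc k)) v Σp , InΣp⇒Pi-kernel k v Σp)
  , φ-InX⇒InΣp k
  , φ-onto-InΣp k
  , φ-Sol⇒PeakSpan (suc (suc k))
  , φ-onto-PeakSpan (suc (suc k))
  , φ-Sol⇒PeakSpan k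
  , φ-onto-PeakSpan k
  , φ-commutes k
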